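{- Let $G$ be a saturated $n$-vertex graph with $e(G) > h\!\left(n,\left\lfloor \frac{n-1}{2}\right\rfloor\right)$, where $h(n,t):=\binom{n-t}{2}+t^2$. Suppose that for $k=\delta(G)$, with $1\leq k\leq \left\lfloor \frac{n-1}{2}\right\rfloor$, there is a subset $D\subseteq V(G)$ of $k$ vertices, each of degree at most $k$, such that $G-D$ is a complete graph. Then $G$ is isomorphic to $H_{n,\delta(G)}$ or to $H'_{n,\delta(G)}$.
   Context: A graph $G$ is called saturated if $G$ is nonhamiltonian but for every pair of nonadjacent vertices $u,v$, the graph $G+uv$ has a hamiltonian cycle. $e(G)$ denotes the number of edges and $\delta(G)$ the minimum degree of $G$. For $d\geq 1$, $H_{n,d}$ is the graph obtained from a complete graph $K_{n-d}$ with vertex set $A$ by adding $d$ new vertices, each of degree $d$, all adjacent to the same $d$ vertices of $A$ (and to nothing else). $H'_{n,d}$ is the $n$-vertex graph that is the edge-disjoint union of two complete graphs $K_{n-d}$ and $K_{d+1}$ sharing exactly one vertex. -}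

module Defs where

open import Data.Nat using (ℕ; zero; suc; _+_; _*_; _∸_; _≤_; _<_; _<ᵇ_; _≤ᵇ_)
import Data.Nat as ℕ
open import Data.Nat.Combinatorics using (_C_)
open import Data.Bool using (Bool; true; false; if_then_else_; _∧_; _∨_; not)
open import Data.Fin using (Fin; zero; suc; toℕ; fromℕ<)
import Data.Fin as Fin
open import Data.Fin.Permutation using (Permutation′; _⟨$⟩ʳ_)
open import Data.Product using (Σ; _×_; ∃)
open import Relation.Nullary using (¬_; yes; no)
open import Relation.Nullary.Decidable using (⌊_⌋)
open import Relation.Binary.PropositionalEquality using (_≡_; _≢_)

Graph : ℕ → Set
Graph n = Fin n → Fin n → Bool

IsSimple : ∀ {n} → Graph n → Set
IsSimple {n} G = (∀ (u v : Fin n) → G u v ≡ G v u) × (∀ (v : Fin n) → G v v ≡ false)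

count : ∀ {n} → (Fin n → Bool) → ℕ
count {zero} f = 0
count {suc n} f = (if f zero then 1 else 0) + count (λ i → f (suc i))

sumF : ∀ {n} → (Fin n → ℕ) → ℕ
sumF {zero} f = 0
sumF {suc n} f = f zero + sumF (λ i → f (suc i))

deg : ∀ {n} → Graph n → Fin n → ℕ
deg G v = count (G v)

e : ∀ {n} → Graph n → ℕ
e G = sumF (λ u → count (λ v → (toℕ u <ᵇ toℕ v) ∧ G u v))

IsMinDegree : ∀ {n} → Graph n → ℕ → Set
IsMinDegree {n} G k = (∀ (v : Fin n) → k ≤ deg G v) × ∃ (λ (v : Fin n) → deg G v ≡ k)

next : ∀ {n} → Fin n → Fin n
next {suc m} i with toℕ i ℕ.<? m
... | yes p = fromℕ< (ℕ.s≤s p)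
... | no _ = zero

Hamiltonian : ∀ {n} → Graph n → Set
Hamiltonian {n} G = (3 ≤ n) × Σ (Permutation′ n) (λ σ → ∀ (i : Fin n) → G (σ ⟨$⟩ʳ i) (σ ⟨$⟩ʳ next i) ≡ true)

_==_ : ∀ {n} → Fin n → Fin n → Bool
x == y = ⌊ x Fin.≟ y ⌋

addEdge : ∀ {n} → Graph n → Fin n → Fin n → Graph n
addEdge G u v x y = G x y ∨ (((x == u) ∧ (y == v)) ∨ ((x == v) ∧ (y == u)))

Saturated : ∀ {n} → Graph n → Set
Saturated {n} G = (¬ Hamiltonian G) ×
  (∀ (u v : Fin n) → u ≢ v → G u v ≡ false → Hamiltonian (addEdge G u v))

_≅_ : ∀ {n} → Graph n → Graph n → Set
_≅_ {n} G H = Σ (Permutation′ n) (λ f → ∀ (u v : Fin n) → G u v ≡ H (f ⟨$⟩ʳ u) (f ⟨$⟩ʳ v))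

-- H_{n,d}: A = {0,…,n-d-1} induces K_{n-d}; B = {n-d,…,n-1} (d vertices),
-- each adjacent exactly to {0,…,d-1} ⊆ A (a subset of A when d ≤ n-d).
H : (n d : ℕ) → Graph n
H n d x y = not (x == y) ∧
  (((toℕ x <ᵇ (n ∸ d)) ∧ (toℕ y <ᵇ (n ∸ d)))
   ∨ (((n ∸ d) ≤ᵇ toℕ x) ∧ (toℕ y <ᵇ d))
   ∨ (((n ∸ d) ≤ᵇ toℕ y) ∧ (toℕ x <ᵇ d)))

-- H'_{n,d}: K_{n-d} on {0,…,n-d-1} and K_{d+1} on {n-d-1,…,n-1}, sharing vertex n-d-1.
H′ : (n d : ℕ) → Graph n
H′ n d x y = not (x == y) ∧
  (((toℕ x <ᵇ (n ∸ d)) ∧ (toℕ y <ᵇ (n ∸ d)))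
   ∨ (((n ∸ d ∸ 1) ≤ᵇ toℕ x) ∧ ((n ∸ d ∸ 1) ≤ᵇ toℕ y)))

h : ℕ → ℕ → ℕ
h n t = ((n ∸ t) C 2) + t * t

module Submission where

-- Let A be the clique V ∖ D. If d ∈ D and x ∈ A are nonadjacent while x has a neighbour in D,
-- then deg d + deg x ≥ k + (n - k) = n, so by the Bondy–Chvátal closure lemma the Hamiltonian
-- graph G + dx would make G Hamiltonian. Hence all vertices of D have the same neighbourhood S
-- in A, and each has k - |S| neighbours inside D. If |S| = k then D is independent and G is
-- H n k; if |S| = 1 then D is a clique and G is H′ n k. Otherwise 2 ≤ |S| < k, and D can be
-- covered by fewer than |S| paths (a maximal path, lengthened by one Pósa rotation if needed);
-- threading these paths between the vertices of S and closing up through A gives a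
-- Hamiltonian cycle.

open import Defs
open import Data.Nat using (ℕ; zero; suc; _+_; _*_; _∸_; _≤_; _<_; _/_; z≤n; s≤s; _<ᵇ_; _≤ᵇ_)
import Data.Nat as ℕ
open import Data.Nat.Properties
open import Data.Nat.DivMod using (m/n*n≤m)
open import Data.Nat.Tactic.RingSolver using (solve-∀)
open import Data.Bool using (Bool; true; false; T?; if_then_else_; _∧_; _∨_; not)
open import Data.Bool.Properties using (∧-identityʳ; ∧-zeroʳ; ∨-identityʳ; ∨-zeroʳ; not-involutive; not-injective; T-≡)
open import Data.Fin using (Fin; zero; suc; toℕ; inject₁; fromℕ; cast)
import Data.Fin as Fin
import Data.Fin.Properties as Fin
open import Data.Fin.Permutation using (Permutation′; _⟨$⟩ʳ_; _⟨$⟩ˡ_; permutation; flip; inverseˡ; inverseʳ)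
open import Data.Fin.Subset using (Subset; _∈_; _∉_; ∣_∣)
open import Data.Vec using ([]; _∷_; lookup)
open import Data.Vec.Properties using ([]=⇒lookup; lookup⇒[]=)
open import Data.Product using (Σ; _×_; _,_; proj₁; proj₂; ∃)
open import Data.Sum using (_⊎_; inj₁; inj₂)
open import Data.Empty using (⊥; ⊥-elim)
open import Relation.Nullary using (¬_; yes; no)
open import Relation.Binary.PropositionalEquality
  using (_≡_; _≢_; refl; sym; trans; cong; cong₂; subst; subst₂; setoid; module ≡-Reasoning)
open import Data.List using (List; []; _∷_; _++_; [_]; length; tabulate; allFin; reverse; map; filterᵇ)
import Data.List as List
import Data.List.Properties as List
open import Data.List.Relation.Unary.All using (All; []; _∷_)
import Data.List.Relation.Unary.All as All
import Data.List.Relation.Unary.All.Properties as All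
open import Data.List.Relation.Unary.Any using (Any; here; there)
import Data.List.Relation.Unary.Any as Any
import Data.List.Relation.Unary.Any.Properties as Any
open import Data.List.Relation.Unary.AllPairs using ([]; _∷_)
open import Data.List.Relation.Unary.Linked using (Linked; []; [-]; _∷_)
import Data.List.Relation.Unary.Linked as Linked
open import Data.List.Relation.Unary.Unique.Propositional using (Unique)
import Data.List.Relation.Unary.Unique.Propositional.Properties as Unique
open import Data.List.Relation.Binary.Disjoint.Propositional using (Disjoint)
import Data.List.Relation.Binary.Disjoint.Propositional.Properties as Disjoint
open import Data.List.Membership.Propositional using () renaming (_∈_ to _∈ₗ_; _∉_ to _∉ₗ_)
open import Data.List.Membership.Propositional.Properties using (∈-tabulate⁺; ∈-lookup; ∈-∃++; ∈-filter⁺; ∈-filter⁻)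
open import Data.List.Membership.Propositional.Properties.WithK using (unique∧set⇒bag)
open import Data.List.Relation.Binary.BagAndSetEquality using (∼bag⇒↭)
open import Data.List.Relation.Binary.Permutation.Propositional
  using (_↭_; prep; ↭-refl; ↭-reflexive; ↭-sym; ↭-trans; ↭⇒↭ₛ)
import Data.List.Relation.Binary.Permutation.Propositional.Properties as ↭
open import Function.Bundles using (mk⇔; Equivalence)

ind : Bool → ℕ
ind b = if b then 1 else 0

false≢true : false ≢ true
false≢true ()

==-refl : ∀ {n} (x : Fin n) → (x == x) ≡ true
==-refl x with x Fin.≟ x
... | yes _ = refl
... | no x≢x = ⊥-elim (x≢x refl)

==-≢ : ∀ {n} {x y : Fin n} → x ≢ y → (x == y) ≡ false
==-≢ {x = x} {y} x≢y with x Fin.≟ y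
... | yes x≡y = ⊥-elim (x≢y x≡y)
... | no _ = refl

==⇒≡ : ∀ {n} {x y : Fin n} → (x == y) ≡ true → x ≡ y
==⇒≡ {x = x} {y} eq with x Fin.≟ y
... | yes x≡y = x≡y

==⇒≢ : ∀ {n} {x y : Fin n} → (x == y) ≡ false → x ≢ y
==⇒≢ {x = x} eq refl = false≢true (trans (sym eq) (==-refl x))

==-sym : ∀ {n} (x y : Fin n) → (x == y) ≡ (y == x)
==-sym x y with x Fin.≟ y | y Fin.≟ x
... | yes _ | yes _ = refl
... | no _ | no _ = refl
... | yes x≡y | no y≢x = ⊥-elim (y≢x (sym x≡y))
... | no x≢y | yes y≡x = ⊥-elim (x≢y (sym y≡x))

==-suc : ∀ {n} (i x : Fin n) → (suc i == suc x) ≡ (i == x)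
==-suc i x with i Fin.≟ x
... | yes _ = refl
... | no _ = refl

∧-true₁ : ∀ {a b} → (a ∧ b) ≡ true → a ≡ true
∧-true₁ {true} _ = refl

∧-true₂ : ∀ {a b} → (a ∧ b) ≡ true → b ≡ true
∧-true₂ {true} h = h

count-cong : ∀ {n} {f g : Fin n → Bool} → (∀ i → f i ≡ g i) → count f ≡ count g
count-cong {zero} eq = refl
count-cong {suc n} eq = cong₂ _+_ (cong ind (eq zero)) (count-cong (λ i → eq (suc i)))

count-mono : ∀ {n} {f g : Fin n → Bool} → (∀ i → f i ≡ true → g i ≡ true) → count f ≤ count g
count-mono {zero} f⊆g = z≤n
count-mono {suc n} {f} {g} f⊆g = +-mono-≤ (ind-mono (f⊆g zero)) (count-mono (λ i → f⊆g (suc i)))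
  where
  ind-mono : ∀ {a b} → (a ≡ true → b ≡ true) → ind a ≤ ind b
  ind-mono {false} _ = z≤n
  ind-mono {true} a⇒b rewrite a⇒b refl = s≤s z≤n

count+count-not : ∀ {n} (f : Fin n → Bool) → count f + count (λ i → not (f i)) ≡ n
count+count-not {zero} f = refl
count+count-not {suc n} f with f zero
... | true = cong suc (count+count-not (λ i → f (suc i)))
... | false = trans (+-suc (count (λ i → f (suc i))) _) (cong suc (count+count-not (λ i → f (suc i))))

count-∨ : ∀ {n} (f g : Fin n → Bool) → (∀ i → f i ≡ true → g i ≡ false) →
  count (λ i → f i ∨ g i) ≡ count f + count g
count-∨ {zero} f g disjoint = refl
count-∨ {suc n} f g disjoint with f zero in fz | g zero in gz
... | true | true with () ← trans (sym (disjoint zero fz)) gz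
... | true | false = cong suc (count-∨ _ _ (λ i → disjoint (suc i)))
... | false | true = trans (cong suc (count-∨ _ _ (λ i → disjoint (suc i)))) (sym (+-suc _ _))
... | false | false = count-∨ _ _ (λ i → disjoint (suc i))

count-false : ∀ {n} (f : Fin n → Bool) → (∀ i → f i ≡ false) → count f ≡ 0
count-false {zero} f none = refl
count-false {suc n} f none rewrite none zero = count-false _ (λ i → none (suc i))

count≡0⇒false : ∀ {n} (f : Fin n → Bool) → count f ≡ 0 → ∀ i → f i ≡ false
count≡0⇒false {suc n} f c≡0 i with f zero in fz
count≡0⇒false {suc n} f c≡0 zero | false = fz
count≡0⇒false {suc n} f c≡0 (suc i) | false = count≡0⇒false (λ j → f (suc j)) c≡0 i

count>0⇒∃ : ∀ {n} (f : Fin n → Bool) → 0 < count f → ∃ λ i → f i ≡ true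
count>0⇒∃ {suc n} f pos with f zero in fz
... | true = zero , fz
... | false with count>0⇒∃ (λ j → f (suc j)) pos
... | i , fi = suc i , fi

count-≡⇒⊇ : ∀ {n} (f g : Fin n → Bool) → (∀ i → f i ≡ true → g i ≡ true) →
  count f ≡ count g → ∀ i → g i ≡ true → f i ≡ true
count-≡⇒⊇ {suc n} f g f⊆g eq i gi with f zero in fz | g zero in gz
count-≡⇒⊇ {suc n} f g f⊆g eq zero gi | true | _ = fz
count-≡⇒⊇ {suc n} f g f⊆g eq zero gi | false | false with () ← trans (sym gi) gz
count-≡⇒⊇ {suc n} f g f⊆g eq (suc i) gi | true | true =
  count-≡⇒⊇ _ _ (λ j → f⊆g (suc j)) (suc-injective eq) i gi
count-≡⇒⊇ {suc n} f g f⊆g eq (suc i) gi | true | false with () ← trans (sym (f⊆g zero fz)) gz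
count-≡⇒⊇ {suc n} f g f⊆g eq (suc i) gi | false | false = count-≡⇒⊇ _ _ (λ j → f⊆g (suc j)) eq i gi
count-≡⇒⊇ {suc n} f g f⊆g eq i gi | false | true =
  ⊥-elim (<-irrefl eq (s≤s (count-mono {f = λ j → f (suc j)} (λ j → f⊆g (suc j)))))

count-== : ∀ {n} (x : Fin n) → count (λ i → i == x) ≡ 1
count-== {suc n} zero = cong suc (count-false (λ (i : Fin n) → suc i == zero) (λ i → refl))
count-== {suc n} (suc x) = trans (count-cong (λ i → ==-suc i x)) (count-== x)

count-remove : ∀ {n} (f : Fin n → Bool) x → f x ≡ true → count f ≡ suc (count (λ y → f y ∧ not (y == x)))
count-remove f x fx = begin
  count f                                                 ≡⟨ count-cong split ⟩
  count (λ y → (f y ∧ not (y == x)) ∨ (y == x))           ≡⟨ count-∨ _ _ disjoint ⟩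
  count (λ y → f y ∧ not (y == x)) + count (λ y → y == x) ≡⟨ cong (count (λ y → f y ∧ not (y == x)) +_) (count-== x) ⟩
  count (λ y → f y ∧ not (y == x)) + 1                    ≡⟨ +-comm _ 1 ⟩
  suc (count (λ y → f y ∧ not (y == x)))                  ∎
  where
  open ≡-Reasoning
  split : ∀ y → f y ≡ ((f y ∧ not (y == x)) ∨ (y == x))
  split y with y == x in y=x
  ... | true rewrite ==⇒≡ y=x = trans fx (sym (∨-zeroʳ _))
  ... | false = sym (trans (∨-identityʳ _) (∧-identityʳ _))
  disjoint : ∀ y → (f y ∧ not (y == x)) ≡ true → (y == x) ≡ false
  disjoint y h with y == x
  ... | false = refl
  ... | true with () ← trans (sym (∧-zeroʳ (f y))) h

search : ∀ {n} (f : Fin n → Bool) → (∃ λ y → f y ≡ true) ⊎ (∀ y → f y ≡ false)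
search f with count f in c
... | zero = inj₂ (count≡0⇒false f c)
... | suc _ = inj₁ (count>0⇒∃ f (subst (0 <_) (sym c) (s≤s z≤n)))

-- Walks as linked lists

lastOf : ∀ {A : Set} → A → List A → A
lastOf x [] = x
lastOf x (y ∷ ys) = lastOf y ys

lastOf-++ : ∀ {A : Set} (x : A) xs y ys → lastOf x (xs ++ y ∷ ys) ≡ lastOf y ys
lastOf-++ x [] y ys = refl
lastOf-++ x (z ∷ zs) y ys = lastOf-++ z zs y ys

lastOf-∈ : ∀ {A : Set} (x : A) xs → lastOf x xs ∈ₗ (x ∷ xs)
lastOf-∈ x [] = here refl
lastOf-∈ x (y ∷ ys) = there (lastOf-∈ y ys)

reverse-∷ : ∀ {A : Set} (x : A) xs → ∃ λ t → reverse (x ∷ xs) ≡ lastOf x xs ∷ t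
reverse-∷ x [] = [] , refl
reverse-∷ x (y ∷ ys) with reverse-∷ y ys
... | t , eq = t List.∷ʳ x , trans (List.unfold-reverse x (y ∷ ys)) (cong (List._∷ʳ x) eq)

module _ {A : Set} {R : A → A → Set} where

  Linked-++⁺ : ∀ {x} xs {y ys} → Linked R (x ∷ xs) → R (lastOf x xs) y → Linked R (y ∷ ys) →
    Linked R (x ∷ xs ++ y ∷ ys)
  Linked-++⁺ [] _ r l = r ∷ l
  Linked-++⁺ (_ ∷ zs) (r₀ ∷ l) r l′ = r₀ ∷ Linked-++⁺ zs l r l′

  Linked-++⁻ : ∀ {x} xs {y ys} → Linked R (x ∷ xs ++ y ∷ ys) →
    Linked R (x ∷ xs) × R (lastOf x xs) y × Linked R (y ∷ ys)
  Linked-++⁻ [] (r ∷ l) = [-] , r , l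
  Linked-++⁻ (_ ∷ zs) (r₀ ∷ l) with Linked-++⁻ zs l
  ... | l₁ , r , l₂ = r₀ ∷ l₁ , r , l₂

  Linked-tail : ∀ {x xs} → Linked R (x ∷ xs) → Linked R xs
  Linked-tail [-] = []
  Linked-tail (_ ∷ l) = l

  Linked-∷ʳ : ∀ ws {y x} → Linked R (ws List.∷ʳ y) → R y x → Linked R (ws ++ y ∷ [ x ])
  Linked-∷ʳ [] _ r = r ∷ [-]
  Linked-∷ʳ (_ ∷ []) (r′ ∷ [-]) r = r′ ∷ r ∷ [-]
  Linked-∷ʳ (_ ∷ w′ ∷ ws) (r′ ∷ l) r = r′ ∷ Linked-∷ʳ (w′ ∷ ws) l r

  Linked-reverse : (∀ {a b} → R a b → R b a) → ∀ {xs} → Linked R xs → Linked R (reverse xs)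
  Linked-reverse R-sym [] = []
  Linked-reverse R-sym [-] = [-]
  Linked-reverse R-sym {x ∷ y ∷ ys} (r ∷ l) = subst (Linked R) (sym unfold)
    (Linked-∷ʳ (reverse ys) (subst (Linked R) (List.unfold-reverse y ys) (Linked-reverse R-sym l)) (R-sym r))
    where
    unfold : reverse (x ∷ y ∷ ys) ≡ reverse ys ++ y ∷ [ x ]
    unfold = trans (List.unfold-reverse x (y ∷ ys))
      (trans (cong (List._∷ʳ x) (List.unfold-reverse y ys)) (List.++-assoc (reverse ys) [ y ] [ x ]))

Exhaustive : ∀ {n} → List (Fin n) → Set
Exhaustive {n} L = ∀ (v : Fin n) → v ∈ₗ L

Unique-resp-↭ : ∀ {n} {xs ys : List (Fin n)} → xs ↭ ys → Unique xs → Unique ys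
Unique-resp-↭ {n} p = Perm.Unique-resp-↭ (↭⇒↭ₛ p)
  where import Data.List.Relation.Binary.Permutation.Setoid.Properties (setoid (Fin n)) as Perm

Exhaustive-resp-↭ : ∀ {n} {xs ys : List (Fin n)} → xs ↭ ys → Exhaustive xs → Exhaustive ys
Exhaustive-resp-↭ p cover v = ↭.∈-resp-↭ p (cover v)

↭-allFin : ∀ {n} (L : List (Fin n)) → Unique L → Exhaustive L → L ↭ allFin n
↭-allFin {n} L unique cover =
  ∼bag⇒↭ (unique∧set⇒bag unique (Unique.allFin⁺ n) (λ {x} → mk⇔ (λ _ → ∈-tabulate⁺ x) (λ _ → cover x)))

length-enumeration : ∀ {n} (L : List (Fin n)) → Unique L → Exhaustive L → length L ≡ n
length-enumeration {n} L unique cover =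
  trans (↭.↭-length (↭-allFin L unique cover)) (List.length-tabulate {n = n} (λ i → i))

countL : ∀ {A : Set} → (A → Bool) → List A → ℕ
countL f [] = 0
countL f (x ∷ xs) = ind (f x) + countL f xs

countL-↭ : ∀ {A : Set} (f : A → Bool) {xs ys} → xs ↭ ys → countL f xs ≡ countL f ys
countL-↭ f _↭_.refl = refl
countL-↭ f (prep x p) = cong (ind (f x) +_) (countL-↭ f p)
countL-↭ f (_↭_.swap x y p) = trans (sym (+-assoc (ind (f x)) (ind (f y)) _))
  (trans (cong₂ _+_ (+-comm (ind (f x)) (ind (f y))) (countL-↭ f p)) (+-assoc (ind (f y)) (ind (f x)) _))
countL-↭ f (_↭_.trans p q) = trans (countL-↭ f p) (countL-↭ f q)

count≡countL-tabulate : ∀ {A : Set} {n} (f : A → Bool) (g : Fin n → A) → count (λ i → f (g i)) ≡ countL f (tabulate g)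
count≡countL-tabulate {n = zero} f g = refl
count≡countL-tabulate {n = suc n} f g = cong (ind (f (g zero)) +_) (count≡countL-tabulate f (λ i → g (suc i)))

count≡countL : ∀ {n} (L : List (Fin n)) → Unique L → Exhaustive L → (f : Fin n → Bool) → count f ≡ countL f L
count≡countL L unique cover f =
  trans (count≡countL-tabulate f (λ i → i)) (sym (countL-↭ f (↭-allFin L unique cover)))

-- Hamiltonian cycles as enumerations

Edge : ∀ {n} → Graph n → Fin n → Fin n → Set
Edge G u v = G u v ≡ true

ClosedWalk : ∀ {n} → Graph n → List (Fin n) → Set
ClosedWalk G [] = ⊥
ClosedWalk G (a ∷ rest) = Linked (Edge G) (a ∷ rest ++ [ a ])

HamiltonianCycle : ∀ {n} → Graph n → List (Fin n) → Set
HamiltonianCycle G L = Unique L × Exhaustive L × ClosedWalk G L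

module _ {A : Set} {R : A → A → Set} where

  Linked-tabulate⁻ : ∀ {m} (g : Fin (suc m) → A) (z : A) → Linked R (tabulate g ++ [ z ]) →
    (∀ (j : Fin m) → R (g (inject₁ j)) (g (suc j))) × R (g (fromℕ m)) z
  Linked-tabulate⁻ {zero} g z (r ∷ [-]) = (λ ()) , r
  Linked-tabulate⁻ {suc m} g z (r ∷ l) with Linked-tabulate⁻ {m} (λ i → g (suc i)) z l
  ... | steps , final = (λ { zero → r ; (suc j) → steps j }) , final

  Linked-tabulate⁺ : ∀ {m} (g : Fin (suc m) → A) (z : A) →
    (∀ (j : Fin m) → R (g (inject₁ j)) (g (suc j))) → R (g (fromℕ m)) z → Linked R (tabulate g ++ [ z ])
  Linked-tabulate⁺ {zero} g z _ r = r ∷ [-]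
  Linked-tabulate⁺ {suc m} g z steps r = steps zero ∷ Linked-tabulate⁺ {m} (λ i → g (suc i)) z (λ j → steps (suc j)) r

next-inject₁ : ∀ {m} (j : Fin m) → next (inject₁ j) ≡ suc j
next-inject₁ {m} j with toℕ (inject₁ j) ℕ.<? m
... | yes p = Fin.toℕ-injective (trans (Fin.toℕ-fromℕ< (s≤s p)) (cong suc (Fin.toℕ-inject₁ j)))
... | no ¬p = ⊥-elim (¬p (subst (_< m) (sym (Fin.toℕ-inject₁ j)) (Fin.toℕ<n j)))

next-fromℕ : ∀ m → next (fromℕ m) ≡ zero
next-fromℕ m with toℕ (fromℕ m) ℕ.<? m
... | yes p = ⊥-elim (<-irrefl (Fin.toℕ-fromℕ m) p)
... | no _ = refl

inject₁-or-fromℕ : ∀ {m} (i : Fin (suc m)) → (∃ λ j → i ≡ inject₁ j) ⊎ i ≡ fromℕ m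
inject₁-or-fromℕ {zero} zero = inj₂ refl
inject₁-or-fromℕ {suc m} zero = inj₁ (zero , refl)
inject₁-or-fromℕ {suc m} (suc i) with inject₁-or-fromℕ i
... | inj₁ (j , eq) = inj₁ (suc j , cong suc eq)
... | inj₂ eq = inj₂ (cong suc eq)

Linked-cyclic⁻ : ∀ {m} {A : Set} {R : A → A → Set} (g : Fin (suc m) → A) → Linked R (tabulate g ++ [ g zero ]) →
  ∀ i → R (g i) (g (next i))
Linked-cyclic⁻ {m} {R = R} g l i with Linked-tabulate⁻ {R = R} g (g zero) l | inject₁-or-fromℕ i
... | steps , _ | inj₁ (j , refl) = subst (λ k → R (g (inject₁ j)) (g k)) (sym (next-inject₁ j)) (steps j)
... | _ , final | inj₂ refl = subst (λ k → R (g (fromℕ m)) (g k)) (sym (next-fromℕ m)) final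

Linked-cyclic⁺ : ∀ {m} {A : Set} {R : A → A → Set} (g : Fin (suc m) → A) → (∀ i → R (g i) (g (next i))) →
  Linked R (tabulate g ++ [ g zero ])
Linked-cyclic⁺ {m} {R = R} g steps = Linked-tabulate⁺ g (g zero)
  (λ j → subst (λ k → R (g (inject₁ j)) (g k)) (next-inject₁ j) (steps (inject₁ j)))
  (subst (λ k → R (g (fromℕ m)) (g k)) (next-fromℕ m) (steps (fromℕ m)))

index-unique : ∀ {A : Set} {L : List A} {v} → Unique L → (p : v ∈ₗ L) → (j : Fin (length L)) →
  List.lookup L j ≡ v → Any.index p ≡ j
index-unique _ (here _) zero _ = refl
index-unique (v∉ ∷ _) (here refl) (suc j) eq = ⊥-elim (All.lookup v∉ (∈-lookup j) (sym eq))
index-unique (v∉ ∷ _) (there p) zero refl = ⊥-elim (All.lookup v∉ p refl)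
index-unique (_ ∷ unique) (there p) (suc j) eq = cong suc (index-unique unique p j eq)

tabulate-lookup : ∀ {A : Set} {n} (L : List A) .(eq : length L ≡ n) → tabulate (λ i → List.lookup L (cast (sym eq) i)) ≡ L
tabulate-lookup {n = zero} [] eq = refl
tabulate-lookup {n = suc n} (x ∷ xs) eq = cong (x ∷_) (tabulate-lookup xs (suc-injective eq))

module Enumeration {n} (L : List (Fin n)) (unique : Unique L) (cover : Exhaustive L) where

  private
    length≡n : length L ≡ n
    length≡n = length-enumeration L unique cover

  position : Fin n → Fin n
  position v = cast length≡n (Any.index (cover v))

  atPosition : Fin n → Fin n
  atPosition i = List.lookup L (cast (sym length≡n) i)

  ordering : Permutation′ n
  ordering = permutation atPosition position
    (λ v → trans (cong (List.lookup L) (Fin.cast-involutive (sym length≡n) length≡n (Any.index (cover v))))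
                 (sym (Any.lookup-index (cover v))))
    (λ i → trans (cong (cast length≡n) (index-unique unique (cover (atPosition i)) (cast (sym length≡n) i) refl))
                 (Fin.cast-involutive length≡n (sym length≡n) i))

  hamiltonian : (G : Graph n) → 3 ≤ n → ClosedWalk G L → Hamiltonian G
  hamiltonian G n≥3@(s≤s _) walk =
    n≥3 , ordering , Linked-cyclic⁻ atPosition (subst (ClosedWalk G) (sym (tabulate-lookup L length≡n)) walk)

HamiltonianCycle⇒Hamiltonian : ∀ {n} (G : Graph n) {L} → 3 ≤ n → HamiltonianCycle G L → Hamiltonian G
HamiltonianCycle⇒Hamiltonian G {L} n≥3 (unique , cover , walk) = Enumeration.hamiltonian L unique cover G n≥3 walk

Hamiltonian⇒HamiltonianCycle : ∀ {n} (G : Graph n) → Hamiltonian G → ∃ (HamiltonianCycle G)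
Hamiltonian⇒HamiltonianCycle {suc m} G (_ , σ , steps) =
  tabulate (σ ⟨$⟩ʳ_) ,
  Unique.tabulate⁺ (λ eq → trans (sym (inverseˡ σ)) (trans (cong (σ ⟨$⟩ˡ_) eq) (inverseˡ σ))) ,
  (λ v → subst (_∈ₗ tabulate (σ ⟨$⟩ʳ_)) (inverseʳ σ) (∈-tabulate⁺ {f = σ ⟨$⟩ʳ_} (σ ⟨$⟩ˡ v))) ,
  Linked-cyclic⁺ (σ ⟨$⟩ʳ_) steps

-- The Bondy–Chvátal closure lemma

add-at-most-one : ∀ a b x y l → a + b ≤ 1 → x + y ≤ l → a + x + (b + y) ≤ suc l
add-at-most-one a b x y l a+b≤1 x+y≤l = subst (_≤ suc l) (shuffle a b x y) (+-mono-≤ a+b≤1 x+y≤l)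
  where
  shuffle : ∀ a b x y → (a + b) + (x + y) ≡ a + x + (b + y)
  shuffle = solve-∀

module BondyChvátal {n} (G : Graph n) (G-sym : ∀ u v → G u v ≡ G v u) (G-irrefl : ∀ v → G v v ≡ false) where

  Edge-sym : ∀ {a b} → Edge G a b → Edge G b a
  Edge-sym {a} {b} e = trans (G-sym b a) e

  NewEdge : Fin n → Fin n → Fin n → Fin n → Set
  NewEdge u v p q = (p ≡ u × q ≡ v) ⊎ (p ≡ v × q ≡ u)

  addEdge⁻ : ∀ u v a b → Edge (addEdge G u v) a b → Edge G a b ⊎ NewEdge u v a b
  addEdge⁻ u v a b _ with G a b | a == u in a=u | b == v in b=v | a == v in a=v | b == u in b=u
  ... | true | _ | _ | _ | _ = inj₁ refl
  ... | false | true | true | _ | _ = inj₂ (inj₁ (==⇒≡ a=u , ==⇒≡ b=v))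
  ... | false | true | false | true | true = inj₂ (inj₂ (==⇒≡ a=v , ==⇒≡ b=u))
  ... | false | false | _ | true | true = inj₂ (inj₂ (==⇒≡ a=v , ==⇒≡ b=u))

  Linked-addEdge⁻ : ∀ u v {x} xs → Linked (Edge (addEdge G u v)) (x ∷ xs) →
    Linked (Edge G) (x ∷ xs) ⊎ (∃ λ α → ∃ λ p → ∃ λ q → ∃ λ β → x ∷ xs ≡ α ++ p ∷ q ∷ β × NewEdge u v p q)
  Linked-addEdge⁻ u v [] _ = inj₁ [-]
  Linked-addEdge⁻ u v {x} (y ∷ ys) (r ∷ l) with Linked-addEdge⁻ u v ys l
  ... | inj₂ (α , p , q , β , eq , new) = inj₂ (x ∷ α , p , q , β , cong (x ∷_) eq , new)
  ... | inj₁ l′ with addEdge⁻ u v x y r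
  ...   | inj₁ r′ = inj₁ (r′ ∷ l′)
  ...   | inj₂ new = inj₂ ([] , x , y , ys , refl , new)

  ≢-endpoints : ∀ {q u v : Fin n} → q ≡ u ⊎ q ≡ v → q ≢ u → q ≢ v → ⊥
  ≢-endpoints (inj₁ q≡u) q≢u _ = q≢u q≡u
  ≢-endpoints (inj₂ q≡v) _ q≢v = q≢v q≡v

  Linked-addEdge-avoiding : ∀ u v q → (q ≡ u ⊎ q ≡ v) → ∀ {xs} →
    Linked (Edge (addEdge G u v)) xs → All (q ≢_) xs → Linked (Edge G) xs
  Linked-addEdge-avoiding u v q _ [] _ = []
  Linked-addEdge-avoiding u v q _ [-] _ = [-]
  Linked-addEdge-avoiding u v q q∈uv {a ∷ b ∷ _} (r ∷ l) (q≢a ∷ q≢b ∷ q∉) with addEdge⁻ u v a b r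
  ... | inj₁ r′ = r′ ∷ Linked-addEdge-avoiding u v q q∈uv l (q≢b ∷ q∉)
  ... | inj₂ (inj₁ (refl , refl)) = ⊥-elim (≢-endpoints q∈uv q≢a q≢b)
  ... | inj₂ (inj₂ (refl , refl)) = ⊥-elim (≢-endpoints q∈uv q≢b q≢a)

  HamiltonianPath : Fin n → List (Fin n) → Set
  HamiltonianPath q ps = Unique (q ∷ ps) × Exhaustive (q ∷ ps) × Linked (Edge G) (q ∷ ps)

  Crossing : Fin n → Fin n → List (Fin n) → Set
  Crossing q p L = ∃ λ α → ∃ λ a → ∃ λ b → ∃ λ β → L ≡ α ++ a ∷ b ∷ β × Edge G q b × Edge G a p

  -- Each consecutive pair a, b of the path contributes to at most one of q ~ b and a ~ p, unless
  -- it contributes to both, which is a crossing.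
  crossing-or-few-edges : (q p : Fin n) → ∀ x xs →
    Crossing q p (x ∷ xs) ⊎ (countL (G q) xs + countL (λ w → G w p) (x ∷ xs) ≤ length xs + ind (G (lastOf x xs) p))
  crossing-or-few-edges q p x [] = inj₂ (≤-reflexive (+-identityʳ (ind (G x p))))
  crossing-or-few-edges q p x (y ∷ ys) with crossing-or-few-edges q p y ys
  ... | inj₁ (α , a , b , β , eq , qb , ap) = inj₁ (x ∷ α , a , b , β , cong (x ∷_) eq , qb , ap)
  ... | inj₂ bound with G q y in qy | G x p in xp
  ...   | true | true = inj₁ ([] , x , y , ys , refl , qy , xp)
  ...   | true | false = inj₂ (add-at-most-one 1 0 (countL (G q) ys) (countL (λ w → G w p) (y ∷ ys)) _ (s≤s z≤n) bound)
  ...   | false | true = inj₂ (add-at-most-one 0 1 (countL (G q) ys) (countL (λ w → G w p) (y ∷ ys)) _ (s≤s z≤n) bound)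
  ...   | false | false = inj₂ (add-at-most-one 0 0 (countL (G q) ys) (countL (λ w → G w p) (y ∷ ys)) _ z≤n bound)

  crossing⇒hamiltonian : 3 ≤ n → ∀ q α a b β → HamiltonianPath q (α ++ a ∷ b ∷ β) →
    Edge G q b → Edge G a (lastOf b β) → Hamiltonian G
  crossing⇒hamiltonian n≥3 q α a b β (unique , cover , path) qb ap
    with Linked-++⁻ α path | reverse-∷ q (b ∷ β)
  ... | toA , edgeToA , fromA | t , rev≡ = HamiltonianCycle⇒Hamiltonian G n≥3 (unique′ , cover′ , walk)
    where
    cycle : List (Fin n)
    cycle = q ∷ α ++ a ∷ reverse (b ∷ β)
    cycle↭path : cycle ↭ (q ∷ α ++ a ∷ b ∷ β)
    cycle↭path = prep q (↭.++⁺ˡ α (prep a (↭.↭-reverse (b ∷ β))))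
    unique′ : Unique cycle
    unique′ = Unique-resp-↭ (↭-sym cycle↭path) unique
    cover′ : Exhaustive cycle
    cover′ = Exhaustive-resp-↭ (↭-sym cycle↭path) cover
    back : Linked (Edge G) (lastOf b β ∷ t)
    back = subst (Linked (Edge G)) rev≡ (Linked-reverse Edge-sym (qb ∷ Linked-tail fromA))
    closes : q ∷ α ++ a ∷ lastOf b β ∷ t ≡ cycle ++ [ q ]
    closes = begin
      q ∷ α ++ a ∷ lastOf b β ∷ t          ≡⟨ cong (λ z → q ∷ α ++ a ∷ z) (sym rev≡) ⟩
      q ∷ α ++ a ∷ reverse (q ∷ b ∷ β)     ≡⟨ cong (λ z → q ∷ α ++ a ∷ z) (List.unfold-reverse q (b ∷ β)) ⟩
      q ∷ α ++ a ∷ reverse (b ∷ β) ++ [ q ] ≡⟨ cong (q ∷_) (sym (List.++-assoc α (a ∷ reverse (b ∷ β)) [ q ])) ⟩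
      cycle ++ [ q ]                        ∎
      where open ≡-Reasoning
    walk : ClosedWalk G cycle
    walk = subst (Linked (Edge G)) closes (Linked-++⁺ α toA edgeToA (ap ∷ back))

  hamiltonianPath⇒hamiltonian : 3 ≤ n → ∀ q ps → HamiltonianPath q ps →
    G q (lastOf q ps) ≡ false → n ≤ deg G q + deg G (lastOf q ps) → Hamiltonian G
  hamiltonianPath⇒hamiltonian n≥3 q ps P@(unique , cover , _) qp≡false n≤deg
    with crossing-or-few-edges q (lastOf q ps) q ps
  ... | inj₁ ([] , _ , _ , _ , refl , _ , qp) = ⊥-elim (false≢true (trans (sym qp≡false) qp))
  ... | inj₁ (_ ∷ α , a , b , β , refl , qb , ap) =
    crossing⇒hamiltonian n≥3 q α a b β P qb (subst (Edge G a) (lastOf-++ q α a (b ∷ β)) ap)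
  ... | inj₂ few = ⊥-elim (<-irrefl refl (<-≤-trans deg<n n≤deg))
    where
    p = lastOf q ps
    deg-q : deg G q ≡ countL (G q) ps
    deg-q = trans (count≡countL (q ∷ ps) unique cover (G q)) (cong (λ z → ind z + countL (G q) ps) (G-irrefl q))
    deg-p : deg G p ≡ countL (λ w → G w p) (q ∷ ps)
    deg-p = trans (count-cong (λ w → G-sym p w)) (count≡countL (q ∷ ps) unique cover (λ w → G w p))
    deg≤ : deg G q + deg G p ≤ length ps
    deg≤ = subst₂ _≤_ (sym (cong₂ _+_ deg-q deg-p))
      (trans (cong (λ z → length ps + ind z) (G-irrefl p)) (+-identityʳ _)) few
    deg<n : deg G q + deg G p < n
    deg<n = subst (deg G q + deg G p <_) (length-enumeration (q ∷ ps) unique cover) (s≤s deg≤)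

  newEdge-endpoint : ∀ {u v p q} → NewEdge u v p q → q ≡ u ⊎ q ≡ v
  newEdge-endpoint (inj₁ (_ , q≡v)) = inj₂ q≡v
  newEdge-endpoint (inj₂ (_ , q≡u)) = inj₁ q≡u

  newEdge-unique : ∀ {u v p q y} → u ≢ v → NewEdge u v p q → NewEdge u v q y → y ≡ p
  newEdge-unique u≢v (inj₁ (refl , refl)) (inj₁ (v≡u , _)) = ⊥-elim (u≢v (sym v≡u))
  newEdge-unique u≢v (inj₁ (refl , refl)) (inj₂ (_ , refl)) = refl
  newEdge-unique u≢v (inj₂ (refl , refl)) (inj₁ (_ , refl)) = refl
  newEdge-unique u≢v (inj₂ (refl , refl)) (inj₂ (u≡v , _)) = ⊥-elim (u≢v u≡v)

  newEdge-nonadjacent : ∀ {u v p q} → G u v ≡ false → NewEdge u v p q → G q p ≡ false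
  newEdge-nonadjacent {u} {v} uv≡false (inj₁ (refl , refl)) = trans (G-sym v u) uv≡false
  newEdge-nonadjacent uv≡false (inj₂ (refl , refl)) = uv≡false

  newEdge-deg : ∀ {u v p q} → NewEdge u v p q → deg G q + deg G p ≡ deg G u + deg G v
  newEdge-deg {u} {v} (inj₁ (refl , refl)) = +-comm (deg G v) (deg G u)
  newEdge-deg (inj₂ (refl , refl)) = refl

  Linked-addEdge-path : ∀ u v → u ≢ v → ∀ q ps → NewEdge u v (lastOf q ps) q → 3 ≤ length (q ∷ ps) →
    Unique (q ∷ ps) → Linked (Edge (addEdge G u v)) (q ∷ ps) → Linked (Edge G) (q ∷ ps)
  Linked-addEdge-path u v u≢v q [] _ (s≤s ()) _ _
  Linked-addEdge-path u v u≢v q (_ ∷ []) _ (s≤s (s≤s ())) _ _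
  Linked-addEdge-path u v u≢v q (y ∷ z ∷ zs) new _ (q∉ ∷ (y∉ ∷ _)) (r ∷ l) with addEdge⁻ u v q y r
  ... | inj₁ r′ = r′ ∷ Linked-addEdge-avoiding u v q (newEdge-endpoint new) l q∉
  ... | inj₂ new′ = ⊥-elim (All.lookup y∉ (lastOf-∈ z zs) (newEdge-unique u≢v new new′))

  rotate : ∀ {R : Fin n → Fin n → Set} α p q β {a rest} → a ∷ rest ≡ α ++ p ∷ q ∷ β →
    Linked R (a ∷ rest ++ [ a ]) → Linked R (q ∷ β ++ α ++ [ p ])
  rotate [] p q β refl l = Linked-tail l
  rotate {R} (a ∷ α) p q β refl l
    with Linked-++⁻ α (subst (Linked R) (cong (a ∷_) (List.++-assoc α (p ∷ q ∷ β) [ a ])) l)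
  ... | toP , edgeToP , (_ ∷ fromQ) with Linked-++⁻ β fromQ
  ... | fromQ′ , closing , _ = Linked-++⁺ β fromQ′ closing (Linked-++⁺ α toP edgeToP [-])

  rotate-↭ : ∀ (α : List (Fin n)) p q β → (q ∷ β ++ α ++ [ p ]) ↭ (α ++ p ∷ q ∷ β)
  rotate-↭ α p q β = subst ((q ∷ β ++ α ++ [ p ]) ↭_) (List.++-assoc α [ p ] (q ∷ β)) (↭.++-comm (q ∷ β) (α ++ [ p ]))

  rotate-lastOf : ∀ (α : List (Fin n)) p q β → lastOf q (β ++ α ++ [ p ]) ≡ p
  rotate-lastOf α p q β = trans (cong (lastOf q) (sym (List.++-assoc β α [ p ]))) (lastOf-++ q (β ++ α) p [])

  addEdge-hamiltonianCycle⁻ : ∀ u v → u ≢ v → 3 ≤ n → ∀ {L} → HamiltonianCycle (addEdge G u v) L →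
    HamiltonianCycle G L ⊎ ∃ λ q → ∃ λ ps → HamiltonianPath q ps × NewEdge u v (lastOf q ps) q
  addEdge-hamiltonianCycle⁻ u v u≢v n≥3 {a ∷ rest} (unique , cover , walk) with Linked-++⁻ rest walk
  ... | path , closing , _ with Linked-addEdge⁻ u v rest path
  ...   | inj₁ pathG with addEdge⁻ u v (lastOf a rest) a closing
  ...     | inj₁ closingG = inj₁ (unique , cover , Linked-++⁺ rest pathG closingG [-])
  ...     | inj₂ new = inj₂ (a , rest , (unique , cover , pathG) , new)
  addEdge-hamiltonianCycle⁻ u v u≢v n≥3 {a ∷ rest} (unique , cover , walk) | _ | inj₂ (α , p , q , β , split , new) =
    inj₂ (q , β ++ α ++ [ p ] , (unique′ , cover′ , Linked-addEdge-path u v u≢v q _ new′ length≥3 unique′ rotated) , new′)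
    where
    rotated↭ : (q ∷ β ++ α ++ [ p ]) ↭ (a ∷ rest)
    rotated↭ = subst ((q ∷ β ++ α ++ [ p ]) ↭_) (sym split) (rotate-↭ α p q β)
    unique′ : Unique (q ∷ β ++ α ++ [ p ])
    unique′ = Unique-resp-↭ (↭-sym rotated↭) unique
    cover′ : Exhaustive (q ∷ β ++ α ++ [ p ])
    cover′ = Exhaustive-resp-↭ (↭-sym rotated↭) cover
    rotated : Linked (Edge (addEdge G u v)) (q ∷ β ++ α ++ [ p ])
    rotated = rotate α p q β split walk
    new′ : NewEdge u v (lastOf q (β ++ α ++ [ p ])) q
    new′ = subst (λ z → NewEdge u v z q) (sym (rotate-lastOf α p q β)) new
    length≥3 : 3 ≤ length (q ∷ β ++ α ++ [ p ])
    length≥3 = subst (3 ≤_) (sym (length-enumeration _ unique′ cover′)) n≥3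

  bondyChvátal : ∀ u v → u ≢ v → G u v ≡ false → 3 ≤ n → n ≤ deg G u + deg G v →
    Hamiltonian (addEdge G u v) → Hamiltonian G
  bondyChvátal u v u≢v uv≡false n≥3 n≤deg ham
    with addEdge-hamiltonianCycle⁻ u v u≢v n≥3 (proj₂ (Hamiltonian⇒HamiltonianCycle _ ham))
  ... | inj₁ cycle = HamiltonianCycle⇒Hamiltonian G n≥3 cycle
  ... | inj₂ (q , ps , path , new) = hamiltonianPath⇒hamiltonian n≥3 q ps path
    (newEdge-nonadjacent uv≡false new) (subst (n ≤_) (sym (newEdge-deg new)) n≤deg)

_∈ᵇ_ : ∀ {n} → Fin n → List (Fin n) → Bool
v ∈ᵇ [] = false
v ∈ᵇ (x ∷ xs) = (v == x) ∨ (v ∈ᵇ xs)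

∈ᵇ⇒∈ : ∀ {n} {v : Fin n} xs → (v ∈ᵇ xs) ≡ true → v ∈ₗ xs
∈ᵇ⇒∈ {v = v} (x ∷ xs) v∈xs with v == x in v=x
... | true = here (==⇒≡ v=x)
... | false = there (∈ᵇ⇒∈ xs v∈xs)

∈⇒∈ᵇ : ∀ {n} {v : Fin n} {xs} → v ∈ₗ xs → (v ∈ᵇ xs) ≡ true
∈⇒∈ᵇ {v = v} (here refl) rewrite ==-refl v = refl
∈⇒∈ᵇ {v = v} {x ∷ _} (there v∈xs) rewrite ∈⇒∈ᵇ v∈xs = ∨-zeroʳ (v == x)

∉ᵇ⇒∉ : ∀ {n} {v : Fin n} {xs} → (v ∈ᵇ xs) ≡ false → v ∉ₗ xs
∉ᵇ⇒∉ v∉xs v∈xs = false≢true (trans (sym v∉xs) (∈⇒∈ᵇ v∈xs))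

∉⇒∉ᵇ : ∀ {n} {v : Fin n} xs → v ∉ₗ xs → (v ∈ᵇ xs) ≡ false
∉⇒∉ᵇ {v = v} xs v∉xs with v ∈ᵇ xs in v∈xs
... | true = ⊥-elim (v∉xs (∈ᵇ⇒∈ xs v∈xs))
... | false = refl

∉ᵇ⇒All≢ : ∀ {n} {y : Fin n} xs → (y ∈ᵇ xs) ≡ false → All (y ≢_) xs
∉ᵇ⇒All≢ xs y∉xs = All.tabulate (λ x∈xs y≡x → ∉ᵇ⇒∉ y∉xs (subst (_∈ₗ xs) (sym y≡x) x∈xs))

members : ∀ {n} → (Fin n → Bool) → List (Fin n)
members {n} f = filterᵇ f (allFin n)

module _ {n} {f : Fin n → Bool} where

  members-unique : Unique (members f)
  members-unique = Unique.filter⁺ _ (Unique.allFin⁺ n)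

  ∈-members⁺ : ∀ {v} → f v ≡ true → v ∈ₗ members f
  ∈-members⁺ {v} fv = ∈-filter⁺ (λ x → T? (f x)) (∈-tabulate⁺ v) (Equivalence.from T-≡ fv)

  ∈-members⁻ : ∀ {v} → v ∈ₗ members f → f v ≡ true
  ∈-members⁻ v∈ = Equivalence.to T-≡ (proj₂ (∈-filter⁻ (λ x → T? (f x)) {xs = allFin n} v∈))

  ∉-members : ∀ {v} → f v ≡ false → v ∉ₗ members f
  ∉-members fv≡false v∈ = false≢true (trans (sym fv≡false) (∈-members⁻ v∈))

  length-members : length (members f) ≡ count f
  length-members = trans (length-filterᵇ (allFin n)) (sym (count≡countL-tabulate f (λ i → i)))
    where
    length-filterᵇ : ∀ xs → length (filterᵇ f xs) ≡ countL f xs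
    length-filterᵇ [] = refl
    length-filterᵇ (x ∷ xs) with f x
    ... | true = cong suc (length-filterᵇ xs)
    ... | false = length-filterᵇ xs

Enumerates : ∀ {n} → (Fin n → Bool) → List (Fin n) → Set
Enumerates f L = Unique L × (∀ {v} → v ∈ₗ L → f v ≡ true) × (∀ v → f v ≡ true → v ∈ₗ L)

members-enumerates : ∀ {n} (f : Fin n → Bool) → Enumerates f (members f)
members-enumerates f = members-unique , ∈-members⁻ , (λ v → ∈-members⁺)

members-disjoint : ∀ {n} {f g : Fin n → Bool} → (∀ v → f v ≡ true → g v ≡ false) → Disjoint (members f) (members g)
members-disjoint f⇒¬g (v∈f , v∈g) = ∉-members (f⇒¬g _ (∈-members⁻ v∈f)) v∈g

Disjoint-++ : ∀ {A : Set} {xs ys zs : List A} → Disjoint xs ys → Disjoint xs zs → Disjoint xs (ys ++ zs)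
Disjoint-++ {ys = ys} xy xz (v∈xs , v∈yz) with Any.++⁻ ys v∈yz
... | inj₁ v∈ys = xy (v∈xs , v∈ys)
... | inj₂ v∈zs = xz (v∈xs , v∈zs)

length-unique : ∀ {n} (xs : List (Fin n)) → Unique xs → length xs ≡ count (_∈ᵇ xs)
length-unique {n} [] _ = sym (count-false {n} (_∈ᵇ []) (λ _ → refl))
length-unique (x ∷ xs) (x∉xs ∷ unique) = sym (begin
  count (λ v → (v == x) ∨ (v ∈ᵇ xs))          ≡⟨ count-∨ _ _ disjoint ⟩
  count (λ v → v == x) + count (_∈ᵇ xs)       ≡⟨ cong₂ _+_ (count-== x) (sym (length-unique xs unique)) ⟩
  suc (length xs)                             ∎)
  where
  open ≡-Reasoning
  disjoint : ∀ v → (v == x) ≡ true → (v ∈ᵇ xs) ≡ false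
  disjoint v v=x rewrite ==⇒≡ v=x = ∉⇒∉ᵇ xs (λ x∈xs → All.lookup x∉xs x∈xs refl)

length-unique-≤ : ∀ {n} (f : Fin n → Bool) (xs : List (Fin n)) → Unique xs → All (λ v → f v ≡ true) xs →
  length xs ≤ count f
length-unique-≤ f xs unique all-f = subst (_≤ count f) (sym (length-unique xs unique))
  (count-mono {f = _∈ᵇ xs} (λ v v∈xs → All.lookup all-f (∈ᵇ⇒∈ xs v∈xs)))

<ᵇ-true : ∀ {a b} → a < b → (a <ᵇ b) ≡ true
<ᵇ-true a<b = Equivalence.to T-≡ (<⇒<ᵇ a<b)

<ᵇ-false : ∀ {a b} → b ≤ a → (a <ᵇ b) ≡ false
<ᵇ-false {a} {b} b≤a with a <ᵇ b in a<ᵇb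
... | false = refl
... | true = ⊥-elim (<-irrefl refl (<-≤-trans (<ᵇ⇒< a b (Equivalence.from T-≡ a<ᵇb)) b≤a))

≤ᵇ-true : ∀ {a b} → a ≤ b → (a ≤ᵇ b) ≡ true
≤ᵇ-true a≤b = Equivalence.to T-≡ (≤⇒≤ᵇ a≤b)

≤ᵇ-false : ∀ {a b} → b < a → (a ≤ᵇ b) ≡ false
≤ᵇ-false {a} {b} b<a with a ≤ᵇ b in a≤ᵇb
... | false = refl
... | true = ⊥-elim (<-irrefl refl (<-≤-trans b<a (≤ᵇ⇒≤ a b (Equivalence.from T-≡ a≤ᵇb))))

module _ {A : Set} where

  index-++ˡ : ∀ {u : A} xs ys (p : u ∈ₗ xs ++ ys) → u ∉ₗ ys → toℕ (Any.index p) < length xs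
  index-++ˡ [] ys p u∉ys = ⊥-elim (u∉ys p)
  index-++ˡ (x ∷ xs) ys (here _) u∉ys = s≤s z≤n
  index-++ˡ (x ∷ xs) ys (there p) u∉ys = s≤s (index-++ˡ xs ys p u∉ys)

  index-++ʳ : ∀ {u : A} xs ys (p : u ∈ₗ xs ++ ys) → u ∉ₗ xs →
    Σ (u ∈ₗ ys) λ q → toℕ (Any.index p) ≡ length xs + toℕ (Any.index q)
  index-++ʳ [] ys p u∉xs = p , refl
  index-++ʳ (x ∷ xs) ys (here u≡x) u∉xs = ⊥-elim (u∉xs (here u≡x))
  index-++ʳ (x ∷ xs) ys (there p) u∉xs with index-++ʳ xs ys p (λ u∈xs → u∉xs (there u∈xs))
  ... | q , eq = q , cong suc eq

  module Blocks (X Y Z : List A) {u : A} (p : u ∈ₗ X ++ Y ++ Z) where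

    index-first : u ∉ₗ Y → u ∉ₗ Z → toℕ (Any.index p) < length X
    index-first u∉Y u∉Z = index-++ˡ X (Y ++ Z) p λ u∈YZ → Data.Sum.[ u∉Y , u∉Z ] (Any.++⁻ Y u∈YZ)
      where import Data.Sum

    index-second : u ∉ₗ X → u ∉ₗ Z → length X ≤ toℕ (Any.index p) × toℕ (Any.index p) < length X + length Y
    index-second u∉X u∉Z with index-++ʳ X (Y ++ Z) p u∉X
    ... | q , eq = subst (length X ≤_) (sym eq) (m≤m+n _ _) ,
                   subst (_< length X + length Y) (sym eq) (+-monoʳ-< (length X) (index-++ˡ Y Z q u∉Z))

    index-third : u ∉ₗ X → u ∉ₗ Y → length X + length Y ≤ toℕ (Any.index p)
    index-third u∉X u∉Y with index-++ʳ X (Y ++ Z) p u∉X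
    ... | q , eq with index-++ʳ Y Z q u∉Y
    ... | _ , eq′ = subst (length X + length Y ≤_)
      (sym (trans eq (trans (cong (length X +_) eq′) (sym (+-assoc (length X) _ _))))) (m≤m+n _ _)

⟨$⟩ʳ-== : ∀ {n} (σ : Permutation′ n) u v → ((σ ⟨$⟩ʳ u) == (σ ⟨$⟩ʳ v)) ≡ (u == v)
⟨$⟩ʳ-== σ u v with u == v in u=v
... | true rewrite ==⇒≡ u=v = ==-refl _
... | false = ==-≢ λ eq → ==⇒≢ u=v (trans (sym (inverseˡ σ)) (trans (cong (σ ⟨$⟩ˡ_) eq) (inverseˡ σ)))

module Positions {n} (L : List (Fin n)) (unique : Unique L) (cover : Exhaustive L) where

  positionOf : Permutation′ n
  positionOf = flip (Enumeration.ordering L unique cover)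

  toℕ-positionOf : ∀ v → toℕ (positionOf ⟨$⟩ʳ v) ≡ toℕ (Any.index (cover v))
  toℕ-positionOf v = Fin.toℕ-cast _ (Any.index (cover v))

H-at : ∀ n k (x y : Fin n) {e a₁ b₁ c₁ a₂ b₂ c₂} → (x == y) ≡ e →
  (toℕ x <ᵇ (n ∸ k)) ≡ a₁ → ((n ∸ k) ≤ᵇ toℕ x) ≡ b₁ → (toℕ x <ᵇ k) ≡ c₁ →
  (toℕ y <ᵇ (n ∸ k)) ≡ a₂ → ((n ∸ k) ≤ᵇ toℕ y) ≡ b₂ → (toℕ y <ᵇ k) ≡ c₂ →
  H n k x y ≡ (not e ∧ ((a₁ ∧ a₂) ∨ ((b₁ ∧ c₂) ∨ (b₂ ∧ c₁))))
H-at n k x y refl refl refl refl refl refl refl = refl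

H′-at : ∀ n k (x y : Fin n) {e a₁ b₁ a₂ b₂} → (x == y) ≡ e →
  (toℕ x <ᵇ (n ∸ k)) ≡ a₁ → ((n ∸ k ∸ 1) ≤ᵇ toℕ x) ≡ b₁ →
  (toℕ y <ᵇ (n ∸ k)) ≡ a₂ → ((n ∸ k ∸ 1) ≤ᵇ toℕ y) ≡ b₂ →
  H′ n k x y ≡ (not e ∧ ((a₁ ∧ a₂) ∨ (b₁ ∧ b₂)))
H′-at n k x y refl refl refl refl refl = refl

-- Interleaving separators with nonempty blocks

module _ {A : Set} where

  Block : Set
  Block = A × List A

  concatBlocks : List Block → List A
  concatBlocks [] = []
  concatBlocks ((h , t) ∷ bs) = h ∷ t ++ concatBlocks bs

  mutual
    interleave : List A → List Block → List A
    interleave [] bs = concatBlocks bs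
    interleave (x ∷ xs) bs = x ∷ interleaveBlocks xs bs

    interleaveBlocks : List A → List Block → List A
    interleaveBlocks xs [] = xs
    interleaveBlocks xs ((h , t) ∷ bs) = h ∷ t ++ interleave xs bs

  interleave-↭ : ∀ xs bs → interleave xs bs ↭ xs ++ concatBlocks bs
  interleave-↭ [] bs = ↭-refl
  interleave-↭ (x ∷ xs) [] = prep x (↭-reflexive (sym (List.++-identityʳ xs)))
  interleave-↭ (x ∷ xs) ((h , t) ∷ bs) =
    prep x (↭-trans (↭.++⁺ˡ (h ∷ t) (interleave-↭ xs bs)) (↭.shifts (h ∷ t) xs))

  concatBlocks-++ : ∀ as bs → concatBlocks (as ++ bs) ≡ concatBlocks as ++ concatBlocks bs
  concatBlocks-++ [] bs = refl
  concatBlocks-++ ((h , t) ∷ as) bs =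
    cong (h ∷_) (trans (cong (t ++_) (concatBlocks-++ as bs)) (sym (List.++-assoc t (concatBlocks as) (concatBlocks bs))))

  singletons : List A → List Block
  singletons = map (_, [])

  concatBlocks-singletons : ∀ xs → concatBlocks (singletons xs) ≡ xs
  concatBlocks-singletons [] = refl
  concatBlocks-singletons (x ∷ xs) = cong (x ∷_) (concatBlocks-singletons xs)

-- The configuration of the theorem

data Part : Set where
  partS partR partD : Part

-- The flag is the adjacency inside D: true for a clique, false for an independent set.
partAdjacency : Bool → Part → Part → Bool
partAdjacency _ partS partS = true
partAdjacency _ partS partR = true
partAdjacency _ partR partS = true
partAdjacency _ partR partR = true
partAdjacency _ partS partD = true
partAdjacency _ partD partS = true
partAdjacency _ partR partD = false
partAdjacency _ partD partR = false
partAdjacency D-clique partD partD = D-clique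

module Configuration {n} (G : Graph n) (G-sym : ∀ u v → G u v ≡ G v u) (G-irrefl : ∀ v → G v v ≡ false)
  (nonhamiltonian : ¬ Hamiltonian G)
  (saturated : ∀ u v → u ≢ v → G u v ≡ false → Hamiltonian (addEdge G u v))
  (k : ℕ) (k≤deg : ∀ v → k ≤ deg G v) (k≥1 : 1 ≤ k) (2k<n : suc (k + k) ≤ n)
  (inD : Fin n → Bool) (|D|≡k : count inD ≡ k)
  (deg-D≤k : ∀ v → inD v ≡ true → deg G v ≤ k)
  (A-complete : ∀ u v → inD u ≡ false → inD v ≡ false → u ≢ v → G u v ≡ true) where

  open BondyChvátal G G-sym G-irrefl

  n≥3 : 3 ≤ n
  n≥3 = ≤-trans (s≤s (+-mono-≤ k≥1 k≥1)) 2k<n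

  deg-D : ∀ d → inD d ≡ true → deg G d ≡ k
  deg-D d d∈D = ≤-antisym (deg-D≤k d d∈D) (k≤deg d)

  inA : Fin n → Bool
  inA v = not (inD v)

  |D|+|A|≡n : k + count inA ≡ n
  |D|+|A|≡n = trans (cong (_+ count inA) (sym |D|≡k)) (count+count-not inD)

  |A|≡n∸k : count inA ≡ n ∸ k
  |A|≡n∸k = sym (trans (cong (_∸ k) (sym |D|+|A|≡n)) (m+n∸m≡n k (count inA)))

  k≤n∸k : k ≤ n ∸ k
  k≤n∸k = subst (k ≤_) |A|≡n∸k
    (+-cancelˡ-≤ k k (count inA) (subst (k + k ≤_) (sym |D|+|A|≡n) (≤-trans (n≤1+n _) 2k<n)))

  D≢A : ∀ {d x} → inD d ≡ true → inD x ≡ false → d ≢ x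
  D≢A d∈D x∈A refl = false≢true (trans (sym x∈A) d∈D)

  G-A : ∀ u v → inD u ≡ false → inD v ≡ false → G u v ≡ not (u == v)
  G-A u v u∈A v∈A with u == v in u=v
  ... | true rewrite ==⇒≡ u=v = G-irrefl v
  ... | false = A-complete u v u∈A v∈A (==⇒≢ u=v)

  nonneighbour-avoids-D : ∀ d x → inD d ≡ true → inD x ≡ false → G d x ≡ false →
    ∀ d′ → inD d′ ≡ true → G x d′ ≡ false
  nonneighbour-avoids-D d x d∈D x∈A dx≡false d′ d′∈D with G x d′ in xd′
  ... | false = refl
  ... | true = ⊥-elim (nonhamiltonian
    (bondyChvátal d x (D≢A d∈D x∈A) dx≡false n≥3 n≤deg (saturated d x (D≢A d∈D x∈A) dx≡false)))
    where
    others : Fin n → Bool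
    others y = inA y ∧ not (y == x)
    neighbours : ∀ y → (others y ∨ (y == d′)) ≡ true → G x y ≡ true
    neighbours y h with inA y in y∈A | y == x in y=x | y == d′ in y=d′
    ... | _ | _ | true rewrite ==⇒≡ y=d′ = xd′
    ... | true | false | false =
      A-complete x y x∈A (trans (sym (not-involutive (inD y))) (cong not y∈A)) (λ x≡y → ==⇒≢ y=x (sym x≡y))
    ... | true | true | false with () ← h
    ... | false | _ | false with () ← h
    disjoint : ∀ y → others y ≡ true → (y == d′) ≡ false
    disjoint y h with y == d′ in y=d′
    ... | false = refl
    ... | true rewrite ==⇒≡ y=d′ | d′∈D with () ← h
    |A|≤deg-x : count inA ≤ deg G x
    |A|≤deg-x = begin
      count inA                          ≡⟨ count-remove inA x (cong not x∈A) ⟩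
      suc (count others)                 ≡⟨ +-comm 1 (count others) ⟩
      count others + 1                   ≡⟨ cong (count others +_) (sym (count-== d′)) ⟩
      count others + count (_== d′)      ≡⟨ sym (count-∨ others (_== d′) disjoint) ⟩
      count (λ y → others y ∨ (y == d′)) ≤⟨ count-mono {f = λ y → others y ∨ (y == d′)} neighbours ⟩
      deg G x                            ∎
      where open ≤-Reasoning
    n≤deg : n ≤ deg G d + deg G x
    n≤deg = subst (_≤ deg G d + deg G x) |D|+|A|≡n
      (+-mono-≤ (≤-reflexive (sym (deg-D d d∈D))) |A|≤deg-x)

  d₀ : Fin n
  d₀ = proj₁ (count>0⇒∃ inD (subst (0 <_) (sym |D|≡k) k≥1))

  d₀∈D : inD d₀ ≡ true
  d₀∈D = proj₂ (count>0⇒∃ inD (subst (0 <_) (sym |D|≡k) k≥1))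

  D-neighbourhood-uniform : ∀ d y → inD d ≡ true → inD y ≡ false → G d y ≡ G d₀ y
  D-neighbourhood-uniform d y d∈D y∈A with G d₀ y in d₀y | G d y in dy
  ... | true | true = refl
  ... | false | false = refl
  ... | true | false =
    ⊥-elim (false≢true (trans (sym (nonneighbour-avoids-D d y d∈D y∈A dy d₀ d₀∈D)) (trans (G-sym y d₀) d₀y)))
  ... | false | true =
    ⊥-elim (false≢true (trans (sym (nonneighbour-avoids-D d₀ y d₀∈D y∈A d₀y d d∈D)) (trans (G-sym y d) dy)))

  inS inR : Fin n → Bool
  inS y = inA y ∧ G d₀ y
  inR y = inA y ∧ not (G d₀ y)

  s : ℕ
  s = count inS

  innerDeg : Fin n → ℕ
  innerDeg d = count (λ y → inD y ∧ G d y)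

  innerDeg+s≡k : ∀ d → inD d ≡ true → innerDeg d + s ≡ k
  innerDeg+s≡k d d∈D = begin
    innerDeg d + s                                     ≡⟨ cong (innerDeg d +_) (count-cong outer≡S) ⟩
    innerDeg d + count (λ y → inA y ∧ G d y)           ≡⟨ sym (count-∨ (λ y → inD y ∧ G d y) _ disjoint) ⟩
    count (λ y → (inD y ∧ G d y) ∨ (inA y ∧ G d y))    ≡⟨ count-cong split ⟩
    deg G d                                            ≡⟨ deg-D d d∈D ⟩
    k                                                  ∎
    where
    open ≡-Reasoning
    outer≡S : ∀ y → inS y ≡ (inA y ∧ G d y)
    outer≡S y with inD y in y∈D
    ... | true = refl
    ... | false = sym (D-neighbourhood-uniform d y d∈D y∈D)
    disjoint : ∀ y → (inD y ∧ G d y) ≡ true → (inA y ∧ G d y) ≡ false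
    disjoint y _ with inD y
    ... | true = refl
    split : ∀ y → ((inD y ∧ G d y) ∨ (inA y ∧ G d y)) ≡ G d y
    split y with inD y
    ... | true = ∨-identityʳ _
    ... | false = refl

  D-neighbour-in-D-∖ : ∀ d → inD d ≡ true → ∀ y → (inD y ∧ G d y) ≡ true → (inD y ∧ not (y == d)) ≡ true
  D-neighbour-in-D-∖ d d∈D y h with inD y | y == d in y=d
  ... | true | false = refl
  ... | true | true rewrite ==⇒≡ y=d | G-irrefl d with () ← h

  innerDeg<k : ∀ d → inD d ≡ true → innerDeg d < k
  innerDeg<k d d∈D = subst (suc (innerDeg d) ≤_) (trans (sym (count-remove inD d d∈D)) |D|≡k)
    (s≤s (count-mono (D-neighbour-in-D-∖ d d∈D)))

  s≥1 : 1 ≤ s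
  s≥1 = +-cancelˡ-< (innerDeg d₀) 0 s
    (subst₂ _<_ (sym (+-identityʳ _)) (sym (innerDeg+s≡k d₀ d₀∈D)) (innerDeg<k d₀ d₀∈D))

  part : Fin n → Part
  part u = if inD u then partD else (if G d₀ u then partS else partR)

  data PartView (u : Fin n) : Set where
    isS : part u ≡ partS → inD u ≡ false → G d₀ u ≡ true → PartView u
    isR : part u ≡ partR → inD u ≡ false → G d₀ u ≡ false → PartView u
    isD : part u ≡ partD → inD u ≡ true → PartView u

  partView : ∀ u → PartView u
  partView u with inD u in u∈D | G d₀ u in d₀u
  ... | true | _ = isD (part-D u∈D) u∈D
    where part-D : inD u ≡ true → part u ≡ partD
          part-D eq rewrite eq = refl
  ... | false | true = isS (part-S u∈D d₀u) u∈D d₀u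
    where part-S : inD u ≡ false → G d₀ u ≡ true → part u ≡ partS
          part-S eq eq′ rewrite eq | eq′ = refl
  ... | false | false = isR (part-R u∈D d₀u) u∈D d₀u
    where part-R : inD u ≡ false → G d₀ u ≡ false → part u ≡ partR
          part-R eq eq′ rewrite eq | eq′ = refl

  G-by-part : (D-clique : Bool) → (∀ u v → inD u ≡ true → inD v ≡ true → G u v ≡ (not (u == v) ∧ D-clique)) →
    ∀ u v → G u v ≡ (not (u == v) ∧ partAdjacency D-clique (part u) (part v))
  G-by-part D-clique G-D u v with partView u | partView v
  ... | isS pu u∈A _ | isS pv v∈A _ rewrite pu | pv = trans (G-A u v u∈A v∈A) (sym (∧-identityʳ _))
  ... | isS pu u∈A _ | isR pv v∈A _ rewrite pu | pv = trans (G-A u v u∈A v∈A) (sym (∧-identityʳ _))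
  ... | isR pu u∈A _ | isS pv v∈A _ rewrite pu | pv = trans (G-A u v u∈A v∈A) (sym (∧-identityʳ _))
  ... | isR pu u∈A _ | isR pv v∈A _ rewrite pu | pv = trans (G-A u v u∈A v∈A) (sym (∧-identityʳ _))
  ... | isD pu u∈D | isD pv v∈D rewrite pu | pv = G-D u v u∈D v∈D
  ... | isD pu u∈D | isS pv v∈A d₀v rewrite pu | pv | ==-≢ (D≢A u∈D v∈A) =
    trans (D-neighbourhood-uniform u v u∈D v∈A) d₀v
  ... | isD pu u∈D | isR pv v∈A d₀v rewrite pu | pv | ==-≢ (D≢A u∈D v∈A) =
    trans (D-neighbourhood-uniform u v u∈D v∈A) d₀v
  ... | isS pu u∈A d₀u | isD pv v∈D rewrite pu | pv | ==-sym u v | ==-≢ (D≢A v∈D u∈A) =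
    trans (G-sym u v) (trans (D-neighbourhood-uniform v u v∈D u∈A) d₀u)
  ... | isR pu u∈A d₀u | isD pv v∈D rewrite pu | pv | ==-sym u v | ==-≢ (D≢A v∈D u∈A) =
    trans (G-sym u v) (trans (D-neighbourhood-uniform v u v∈D u∈A) d₀u)

  S⇒ : ∀ {v} → inS v ≡ true → inD v ≡ false × G d₀ v ≡ true
  S⇒ {v} h with inD v | G d₀ v
  ... | false | true = refl , refl

  R⇒ : ∀ {v} → inR v ≡ true → inD v ≡ false × G d₀ v ≡ false
  R⇒ {v} h with inD v | G d₀ v
  ... | false | false = refl , refl

  ⇒S : ∀ {v} → inD v ≡ false → G d₀ v ≡ true → inS v ≡ true
  ⇒S v∈A d₀v rewrite v∈A = d₀v

  ⇒R : ∀ {v} → inD v ≡ false → G d₀ v ≡ false → inR v ≡ true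
  ⇒R v∈A d₀v rewrite v∈A | d₀v = refl

  D⇒∉S : ∀ {v} → inD v ≡ true → inS v ≡ false
  D⇒∉S v∈D rewrite v∈D = refl

  D⇒∉R : ∀ {v} → inD v ≡ true → inR v ≡ false
  D⇒∉R v∈D rewrite v∈D = refl

  R⇒∉S : ∀ {v} → G d₀ v ≡ false → inS v ≡ false
  R⇒∉S {v} d₀v rewrite d₀v = ∧-zeroʳ _

  S⇒∉R : ∀ {v} → G d₀ v ≡ true → inR v ≡ false
  S⇒∉R {v} d₀v rewrite d₀v = ∧-zeroʳ _

  S⇒A : ∀ {v} → inS v ≡ true → inD v ≡ false
  S⇒A h = proj₁ (S⇒ h)

  s+|R|≡n∸k : s + count inR ≡ n ∸ k
  s+|R|≡n∸k = trans (sym (count-∨ inS inR (λ v h → S⇒∉R (proj₂ (S⇒ h))))) (trans (count-cong S∨R≡A) |A|≡n∸k)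
    where
    S∨R≡A : ∀ v → (inS v ∨ inR v) ≡ inA v
    S∨R≡A v with inD v | G d₀ v
    ... | true | _ = refl
    ... | false | true = refl
    ... | false | false = refl

  Sl Rl Dl : List (Fin n)
  Sl = members inS
  Rl = members inR
  Dl = members inD

  length-Sl : length Sl ≡ s
  length-Sl = length-members {f = inS}

  length-Rl : length Rl ≡ count inR
  length-Rl = length-members {f = inR}

  S#R : Disjoint Sl Rl
  S#R = members-disjoint (λ v h → S⇒∉R (proj₂ (S⇒ h)))

  S#D : Disjoint Sl Dl
  S#D = members-disjoint (λ v h → proj₁ (S⇒ h))

  R#D : Disjoint Rl Dl
  R#D = members-disjoint (λ v h → proj₁ (R⇒ h))

  -- Listing S, then R, then D realises H n k: positions below k form S, those below n - k form A.
  module ≅H (s≡k : s ≡ k) (D-independent : ∀ u v → inD u ≡ true → inD v ≡ true → G u v ≡ false) where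

    L : List (Fin n)
    L = Sl ++ Rl ++ Dl

    unique : Unique L
    unique = Unique.++⁺ members-unique (Unique.++⁺ members-unique members-unique R#D) (Disjoint-++ S#R S#D)

    cover : Exhaustive L
    cover v with partView v
    ... | isS _ v∈A d₀v = Any.++⁺ˡ (∈-members⁺ (⇒S v∈A d₀v))
    ... | isR _ v∈A d₀v = Any.++⁺ʳ Sl (Any.++⁺ˡ (∈-members⁺ (⇒R v∈A d₀v)))
    ... | isD _ v∈D = Any.++⁺ʳ Sl (Any.++⁺ʳ Rl (∈-members⁺ v∈D))

    open Positions L unique cover

    A? D? S? : Part → Bool
    A? partD = false
    A? _ = true
    D? partD = true
    D? _ = false
    S? partS = true
    S? _ = false

    |S|≡k : length Sl ≡ k
    |S|≡k = trans length-Sl s≡k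

    |S|+|R|≡n∸k : length Sl + length Rl ≡ n ∸ k
    |S|+|R|≡n∸k = trans (cong₂ _+_ length-Sl length-Rl) s+|R|≡n∸k

    Region : ℕ → Part → Set
    Region t c = ((t <ᵇ (n ∸ k)) ≡ A? c) × (((n ∸ k) ≤ᵇ t) ≡ D? c) × ((t <ᵇ k) ≡ S? c)

    region-index : ∀ u (p : u ∈ₗ L) → Region (toℕ (Any.index p)) (part u)
    region-index u p with partView u
    ... | isS pu u∈A d₀u rewrite pu =
      let i<k = subst (toℕ (Any.index p) <_) |S|≡k
                  (Blocks.index-first Sl Rl Dl p (∉-members (S⇒∉R d₀u)) (∉-members u∈A))
      in <ᵇ-true (<-≤-trans i<k k≤n∸k) , ≤ᵇ-false (<-≤-trans i<k k≤n∸k) , <ᵇ-true i<k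
    ... | isR pu u∈A d₀u rewrite pu =
      let (|S|≤i , i<|S|+|R|) = Blocks.index-second Sl Rl Dl p (∉-members (R⇒∉S d₀u)) (∉-members u∈A)
          i<n∸k = subst (toℕ (Any.index p) <_) |S|+|R|≡n∸k i<|S|+|R|
      in <ᵇ-true i<n∸k , ≤ᵇ-false i<n∸k , <ᵇ-false (subst (_≤ toℕ (Any.index p)) |S|≡k |S|≤i)
    ... | isD pu u∈D rewrite pu =
      let n∸k≤i = subst (_≤ toℕ (Any.index p)) |S|+|R|≡n∸k
                    (Blocks.index-third Sl Rl Dl p (∉-members (D⇒∉S u∈D)) (∉-members (D⇒∉R u∈D)))
      in <ᵇ-false n∸k≤i , ≤ᵇ-true n∸k≤i , <ᵇ-false (≤-trans k≤n∸k n∸k≤i)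

    region : ∀ u → Region (toℕ (positionOf ⟨$⟩ʳ u)) (part u)
    region u = subst (λ t → Region t (part u)) (sym (toℕ-positionOf u)) (region-index u (cover u))

    H-by-part : ∀ c₁ c₂ → ((A? c₁ ∧ A? c₂) ∨ ((D? c₁ ∧ S? c₂) ∨ (D? c₂ ∧ S? c₁))) ≡ partAdjacency false c₁ c₂
    H-by-part partS partS = refl
    H-by-part partS partR = refl
    H-by-part partS partD = refl
    H-by-part partR partS = refl
    H-by-part partR partR = refl
    H-by-part partR partD = refl
    H-by-part partD partS = refl
    H-by-part partD partR = refl
    H-by-part partD partD = refl

    iso : G ≅ H n k
    iso = positionOf , λ u v →
      let (a₁ , b₁ , c₁) = region u
          (a₂ , b₂ , c₂) = region v
      in trans (G-by-part false (λ u v u∈D v∈D → trans (D-independent u v u∈D v∈D) (sym (∧-zeroʳ _))) u v)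
           (sym (trans (H-at n k (positionOf ⟨$⟩ʳ u) (positionOf ⟨$⟩ʳ v) (⟨$⟩ʳ-== positionOf u v) a₁ b₁ c₁ a₂ b₂ c₂)
                       (cong (not (u == v) ∧_) (H-by-part (part u) (part v)))))

  -- Listing R, then the single vertex of S, then D realises H′ n k, the shared vertex being S.
  module ≅H′ (s≡1 : s ≡ 1) (D-clique : ∀ u v → inD u ≡ true → inD v ≡ true → u ≢ v → G u v ≡ true) where

    L : List (Fin n)
    L = Rl ++ Sl ++ Dl

    unique : Unique L
    unique = Unique.++⁺ members-unique (Unique.++⁺ members-unique members-unique S#D)
      (Disjoint-++ (Disjoint.sym S#R) R#D)

    cover : Exhaustive L
    cover v with partView v
    ... | isR _ v∈A d₀v = Any.++⁺ˡ (∈-members⁺ (⇒R v∈A d₀v))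
    ... | isS _ v∈A d₀v = Any.++⁺ʳ Rl (Any.++⁺ˡ (∈-members⁺ (⇒S v∈A d₀v)))
    ... | isD _ v∈D = Any.++⁺ʳ Rl (Any.++⁺ʳ Sl (∈-members⁺ v∈D))

    open Positions L unique cover

    A? SD? : Part → Bool
    A? partD = false
    A? _ = true
    SD? partR = false
    SD? _ = true

    |R|≡n∸k∸1 : length Rl ≡ n ∸ k ∸ 1
    |R|≡n∸k∸1 = trans length-Rl (sym (trans (cong (_∸ 1) (sym s+|R|≡n∸k)) (cong (λ z → z + count inR ∸ 1) s≡1)))

    |R|+|S|≡n∸k : length Rl + length Sl ≡ n ∸ k
    |R|+|S|≡n∸k = trans (+-comm (length Rl) (length Sl)) (trans (cong₂ _+_ length-Sl length-Rl) s+|R|≡n∸k)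

    n∸k∸1≤n∸k : n ∸ k ∸ 1 ≤ n ∸ k
    n∸k∸1≤n∸k = m∸n≤m (n ∸ k) 1

    Region : ℕ → Part → Set
    Region t c = ((t <ᵇ (n ∸ k)) ≡ A? c) × (((n ∸ k ∸ 1) ≤ᵇ t) ≡ SD? c)

    region-index : ∀ u (p : u ∈ₗ L) → Region (toℕ (Any.index p)) (part u)
    region-index u p with partView u
    ... | isR pu u∈A d₀u rewrite pu =
      let i<n∸k∸1 = subst (toℕ (Any.index p) <_) |R|≡n∸k∸1
                      (Blocks.index-first Rl Sl Dl p (∉-members (R⇒∉S d₀u)) (∉-members u∈A))
      in <ᵇ-true (<-≤-trans i<n∸k∸1 n∸k∸1≤n∸k) , ≤ᵇ-false i<n∸k∸1
    ... | isS pu u∈A d₀u rewrite pu =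
      let (|R|≤i , i<|R|+|S|) = Blocks.index-second Rl Sl Dl p (∉-members (S⇒∉R d₀u)) (∉-members u∈A)
      in <ᵇ-true (subst (toℕ (Any.index p) <_) |R|+|S|≡n∸k i<|R|+|S|) ,
         ≤ᵇ-true (subst (_≤ toℕ (Any.index p)) |R|≡n∸k∸1 |R|≤i)
    ... | isD pu u∈D rewrite pu =
      let n∸k≤i = subst (_≤ toℕ (Any.index p)) |R|+|S|≡n∸k
                    (Blocks.index-third Rl Sl Dl p (∉-members (D⇒∉R u∈D)) (∉-members (D⇒∉S u∈D)))
      in <ᵇ-false n∸k≤i , ≤ᵇ-true (≤-trans n∸k∸1≤n∸k n∸k≤i)

    region : ∀ u → Region (toℕ (positionOf ⟨$⟩ʳ u)) (part u)
    region u = subst (λ t → Region t (part u)) (sym (toℕ-positionOf u)) (region-index u (cover u))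

    H′-by-part : ∀ c₁ c₂ → ((A? c₁ ∧ A? c₂) ∨ (SD? c₁ ∧ SD? c₂)) ≡ partAdjacency true c₁ c₂
    H′-by-part partS partS = refl
    H′-by-part partS partR = refl
    H′-by-part partS partD = refl
    H′-by-part partR partS = refl
    H′-by-part partR partR = refl
    H′-by-part partR partD = refl
    H′-by-part partD partS = refl
    H′-by-part partD partR = refl
    H′-by-part partD partD = refl

    G-D : ∀ u v → inD u ≡ true → inD v ≡ true → G u v ≡ (not (u == v) ∧ true)
    G-D u v u∈D v∈D with u == v in u=v
    ... | true rewrite ==⇒≡ u=v = G-irrefl v
    ... | false = D-clique u v u∈D v∈D (==⇒≢ u=v)

    iso : G ≅ H′ n k
    iso = positionOf , λ u v →
      let (a₁ , b₁) = region u
          (a₂ , b₂) = region v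
      in trans (G-by-part true G-D u v)
           (sym (trans (H′-at n k (positionOf ⟨$⟩ʳ u) (positionOf ⟨$⟩ʳ v) (⟨$⟩ʳ-== positionOf u v) a₁ b₁ a₂ b₂)
                       (cong (not (u == v) ∧_) (H′-by-part (part u) (part v)))))

  Adjacent : Fin n → Fin n → Set
  Adjacent u v = u ≢ v → Edge G u v

  Linked-Adjacent⇒Linked : ∀ {xs} → Unique xs → Linked Adjacent xs → Linked (Edge G) xs
  Linked-Adjacent⇒Linked _ [] = []
  Linked-Adjacent⇒Linked _ [-] = [-]
  Linked-Adjacent⇒Linked ((x≢y ∷ _) ∷ unique) (r ∷ l) = r x≢y ∷ Linked-Adjacent⇒Linked unique l

  A-Linked : ∀ xs → All (λ v → inD v ≡ false) xs → Linked Adjacent xs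
  A-Linked [] _ = []
  A-Linked (_ ∷ []) _ = [-]
  A-Linked (x ∷ y ∷ ys) (x∈A ∷ y∈A ∷ ys⊆A) = A-complete x y x∈A y∈A ∷ A-Linked (y ∷ ys) (y∈A ∷ ys⊆A)

  D-S-edge : ∀ {d x} → inD d ≡ true → inS x ≡ true → Edge G d x
  D-S-edge {d} {x} d∈D x∈S = trans (D-neighbourhood-uniform d x d∈D (S⇒A x∈S)) (proj₂ (S⇒ x∈S))

  S-D-edge : ∀ {x d} → inS x ≡ true → inD d ≡ true → Edge G x d
  S-D-edge {x} {d} x∈S d∈D = trans (G-sym x d) (D-S-edge d∈D x∈S)

  DPath : Block → Set
  DPath (h , t) = Linked (Edge G) (h ∷ t) × All (λ v → inD v ≡ true) (h ∷ t)

  interleave-Linked : ∀ x xs bs T → inS x ≡ true → All (λ v → inS v ≡ true) xs → All DPath bs →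
    length bs ≤ length xs → All (λ v → inD v ≡ false) T → Linked Adjacent (x ∷ interleaveBlocks xs bs ++ T)
  interleave-Linked x xs [] T x∈S xs⊆S _ _ T⊆A =
    A-Linked (x ∷ xs ++ T) (S⇒A x∈S ∷ All.++⁺ (All.map S⇒A xs⊆S) T⊆A)
  interleave-Linked x (x′ ∷ xs) ((h , t) ∷ bs) T x∈S (x′∈S ∷ xs⊆S) ((path , path⊆D) ∷ bs-paths) (s≤s len) T⊆A =
    subst (λ z → Linked Adjacent (x ∷ h ∷ z)) (sym (List.++-assoc t (x′ ∷ interleaveBlocks xs bs) T))
      ((λ _ → S-D-edge x∈S (All.lookup path⊆D (here refl))) ∷
        Linked-++⁺ t (Linked.map (λ r _ → r) path)
          (λ _ → D-S-edge (All.lookup path⊆D (lastOf-∈ h t)) x′∈S)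
          (interleave-Linked x′ xs bs T x′∈S xs⊆S bs-paths len T⊆A))

  -- The cycle s₁ P₁ s₂ P₂ ⋯ s_m P_m s_{m+1} ⋯ s_|S| followed by R: every vertex of S is adjacent
  -- to all of D, and A is a clique.
  hamiltonian-from-path-cover : ∀ {SL RL} → Enumerates inS SL → Enumerates inR RL → ∀ paths →
    Enumerates inD (concatBlocks paths) → All DPath paths → length paths < length SL → 1 ≤ length RL → Hamiltonian G
  hamiltonian-from-path-cover {s₁ ∷ ss} {r₁ ∷ rs} (S-unique , ⊆S , S⊆) (R-unique , ⊆R , R⊆) paths (D-unique , ⊆D , D⊆)
    all-paths (s≤s paths≤ss) _ = HamiltonianCycle⇒Hamiltonian G n≥3 (unique , exhaustive , walk)
    where
    C : List (Fin n)
    C = s₁ ∷ interleaveBlocks ss paths ++ r₁ ∷ rs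
    C↭ : C ↭ (s₁ ∷ ss) ++ (concatBlocks paths ++ r₁ ∷ rs)
    C↭ = subst (C ↭_) (List.++-assoc (s₁ ∷ ss) (concatBlocks paths) (r₁ ∷ rs))
      (↭.++⁺ʳ (r₁ ∷ rs) (interleave-↭ (s₁ ∷ ss) paths))
    disjoint : ∀ {f g : Fin n → Bool} {xs ys} → (∀ {v} → v ∈ₗ xs → f v ≡ true) → (∀ {v} → v ∈ₗ ys → g v ≡ true) →
      (∀ {v} → f v ≡ true → g v ≡ false) → Disjoint xs ys
    disjoint ⊆f ⊆g f⇒¬g (v∈xs , v∈ys) = false≢true (trans (sym (f⇒¬g (⊆f v∈xs))) (⊆g v∈ys))
    unique : Unique C
    unique = Unique-resp-↭ (↭-sym C↭) (Unique.++⁺ S-unique (Unique.++⁺ D-unique R-unique (disjoint ⊆D ⊆R D⇒∉R))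
      (Disjoint-++ (disjoint ⊆S ⊆D S⇒A) (disjoint ⊆S ⊆R (λ v∈S → S⇒∉R (proj₂ (S⇒ v∈S))))))
    exhaustive : Exhaustive C
    exhaustive = Exhaustive-resp-↭ (↭-sym C↭) λ v → case (partView v)
      where
      case : ∀ {v} → PartView v → v ∈ₗ (s₁ ∷ ss) ++ (concatBlocks paths ++ r₁ ∷ rs)
      case {v} (isS _ v∈A d₀v) = Any.++⁺ˡ (S⊆ v (⇒S v∈A d₀v))
      case {v} (isR _ v∈A d₀v) = Any.++⁺ʳ (s₁ ∷ ss) (Any.++⁺ʳ (concatBlocks paths) (R⊆ v (⇒R v∈A d₀v)))
      case {v} (isD _ v∈D) = Any.++⁺ʳ (s₁ ∷ ss) (Any.++⁺ˡ (D⊆ v v∈D))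
    adjacent : Linked Adjacent (s₁ ∷ (interleaveBlocks ss paths ++ r₁ ∷ rs) ++ [ s₁ ])
    adjacent = subst (λ z → Linked Adjacent (s₁ ∷ z)) (sym (List.++-assoc (interleaveBlocks ss paths) (r₁ ∷ rs) [ s₁ ]))
      (interleave-Linked s₁ ss paths (r₁ ∷ rs ++ [ s₁ ]) (⊆S (here refl)) (All.tabulate (λ v∈ss → ⊆S (there v∈ss)))
        all-paths paths≤ss (All.++⁺ (All.tabulate (λ v∈R → proj₁ (R⇒ (⊆R v∈R)))) (S⇒A (⊆S (here refl)) ∷ [])))
    last≢s₁ : lastOf s₁ (interleaveBlocks ss paths ++ r₁ ∷ rs) ≢ s₁
    last≢s₁ eq = false≢true (trans (sym (proj₂ (R⇒ (⊆R last∈R)))) (trans (cong (G d₀) eq) (proj₂ (S⇒ (⊆S (here refl))))))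
      where
      last∈R : lastOf s₁ (interleaveBlocks ss paths ++ r₁ ∷ rs) ∈ₗ r₁ ∷ rs
      last∈R = subst (_∈ₗ r₁ ∷ rs) (sym (lastOf-++ s₁ (interleaveBlocks ss paths) r₁ rs)) (lastOf-∈ r₁ rs)
    walk : ClosedWalk G C
    walk with Linked-++⁻ (interleaveBlocks ss paths ++ r₁ ∷ rs) adjacent
    ... | open-path , closing , _ =
      Linked-++⁺ (interleaveBlocks ss paths ++ r₁ ∷ rs) (Linked-Adjacent⇒Linked unique open-path) (closing last≢s₁) [-]

  DPaths⊆D : ∀ bs → All DPath bs → All (λ v → inD v ≡ true) (concatBlocks bs)
  DPaths⊆D [] [] = []
  DPaths⊆D ((h , t) ∷ bs) ((_ , h∷t⊆D) ∷ bs-paths) = All.++⁺ h∷t⊆D (DPaths⊆D bs bs-paths)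

  outside : List (Fin n) → Fin n → Bool
  outside X v = inD v ∧ not (v ∈ᵇ X)

  length+outside≡k : ∀ X → Unique X → All (λ v → inD v ≡ true) X → length X + count (outside X) ≡ k
  length+outside≡k X unique X⊆D = begin
    length X + count (outside X)                                  ≡⟨ cong (_+ count (outside X)) (length-unique X unique) ⟩
    count (_∈ᵇ X) + count (outside X)                             ≡⟨ cong (_+ count (outside X)) (count-cong inside) ⟩
    count (λ v → inD v ∧ (v ∈ᵇ X)) + count (outside X)            ≡⟨ sym (count-∨ _ _ disjoint) ⟩
    count (λ v → (inD v ∧ (v ∈ᵇ X)) ∨ outside X v)                ≡⟨ count-cong split ⟩
    count inD                                                     ≡⟨ |D|≡k ⟩
    k                                                             ∎
    where
    open ≡-Reasoning
    inside : ∀ v → (v ∈ᵇ X) ≡ (inD v ∧ (v ∈ᵇ X))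
    inside v with v ∈ᵇ X in v∈X
    ... | true rewrite All.lookup X⊆D (∈ᵇ⇒∈ X v∈X) = refl
    ... | false = sym (∧-zeroʳ _)
    disjoint : ∀ v → (inD v ∧ (v ∈ᵇ X)) ≡ true → outside X v ≡ false
    disjoint v h with v ∈ᵇ X
    ... | true = ∧-zeroʳ _
    ... | false with () ← trans (sym (∧-zeroʳ (inD v))) h
    split : ∀ v → ((inD v ∧ (v ∈ᵇ X)) ∨ outside X v) ≡ inD v
    split v with inD v | v ∈ᵇ X
    ... | true | true = refl
    ... | true | false = refl
    ... | false | _ = refl

  complete-path-cover : ∀ paths → Unique (concatBlocks paths) → All DPath paths →
    ∃ λ cover → Enumerates inD (concatBlocks cover) × All DPath cover ×
      length cover + length (concatBlocks paths) ≡ length paths + k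
  complete-path-cover paths X-unique all-paths =
    cover , (unique , ⊆D , D⊆) , All.++⁺ all-paths (singleton-paths rest (∈-members⁻ {f = outside X})) , length≡
    where
    X = concatBlocks paths
    X⊆D = DPaths⊆D paths all-paths
    rest = members (outside X)
    cover = paths ++ singletons rest
    concat≡ : concatBlocks cover ≡ X ++ rest
    concat≡ = trans (concatBlocks-++ paths _) (cong (X ++_) (concatBlocks-singletons rest))
    singleton-paths : ∀ xs → (∀ {v} → v ∈ₗ xs → outside X v ≡ true) → All DPath (singletons xs)
    singleton-paths [] _ = []
    singleton-paths (x ∷ xs) ⊆rest = ([-] , ∧-true₁ (⊆rest (here refl)) ∷ [])
      ∷ singleton-paths xs (λ v∈xs → ⊆rest (there v∈xs))
    unique : Unique (concatBlocks cover)
    unique = subst Unique (sym concat≡) (Unique.++⁺ X-unique members-unique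
      λ {v} (v∈X , v∈rest) → false≢true (trans (sym (cong not (∈⇒∈ᵇ v∈X))) (∧-true₂ (∈-members⁻ v∈rest))))
    ⊆D : ∀ {v} → v ∈ₗ concatBlocks cover → inD v ≡ true
    ⊆D v∈ with Any.++⁻ X (subst (_ ∈ₗ_) concat≡ v∈)
    ... | inj₁ v∈X = All.lookup X⊆D v∈X
    ... | inj₂ v∈rest = ∧-true₁ (∈-members⁻ v∈rest)
    D⊆ : ∀ v → inD v ≡ true → v ∈ₗ concatBlocks cover
    D⊆ v v∈D with v ∈ᵇ X in v∈X
    ... | true = subst (v ∈ₗ_) (sym concat≡) (Any.++⁺ˡ (∈ᵇ⇒∈ X v∈X))
    ... | false = subst (v ∈ₗ_) (sym concat≡) (Any.++⁺ʳ X (∈-members⁺ (cong₂ _∧_ v∈D (cong not v∈X))))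
    length≡ : length cover + length X ≡ length paths + k
    length≡ = begin
      length cover + length X                          ≡⟨ cong (_+ length X) (List.length-++ paths) ⟩
      length paths + length (singletons rest) + length X ≡⟨ cong (λ z → length paths + z + length X) (List.length-map _ rest) ⟩
      length paths + length rest + length X            ≡⟨ +-assoc (length paths) _ _ ⟩
      length paths + (length rest + length X)          ≡⟨ cong (length paths +_) (+-comm (length rest) (length X)) ⟩
      length paths + (length X + length rest)          ≡⟨ cong (λ z → length paths + (length X + z)) (length-members {f = outside X}) ⟩
      length paths + (length X + count (outside X))    ≡⟨ cong (length paths +_) (length+outside≡k X X-unique X⊆D) ⟩
      length paths + k                                 ∎
      where open ≡-Reasoning

  extends : Fin n → List (Fin n) → Fin n → Bool
  extends q Q y = inD y ∧ (G q y ∧ not (y ∈ᵇ Q))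

  UniqueDPath : Fin n → List (Fin n) → Set
  UniqueDPath q qs = Unique (q ∷ qs) × DPath (q , qs)

  extend-greedily : (fuel : ℕ) (q : Fin n) (qs : List (Fin n)) → UniqueDPath q qs →
    ∃ λ q′ → ∃ λ qs′ → UniqueDPath q′ qs′ ×
      ((∀ y → extends q′ (q′ ∷ qs′) y ≡ false) ⊎ fuel + length (q ∷ qs) ≤ length (q′ ∷ qs′))
  extend-greedily zero q qs P = q , qs , P , inj₂ ≤-refl
  extend-greedily (suc fuel) q qs P@(unique , path , ⊆D) with search (extends q (q ∷ qs))
  ... | inj₂ maximal = q , qs , P , inj₁ maximal
  ... | inj₁ (y , extends-y) with inD y in y∈D | G q y in qy | y ∈ᵇ (q ∷ qs) in y∈Q
  ...   | true | true | false
    with extend-greedily fuel y (q ∷ qs) (∉ᵇ⇒All≢ (q ∷ qs) y∈Q ∷ unique , Edge-sym qy ∷ path , y∈D ∷ ⊆D)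
  ...     | q′ , qs′ , P′ , inj₁ maximal = q′ , qs′ , P′ , inj₁ maximal
  ...     | q′ , qs′ , P′ , inj₂ long = q′ , qs′ , P′ , inj₂ (subst (_≤ length (q′ ∷ qs′)) (+-suc fuel _) long)
  extend-greedily (suc fuel) q qs P | inj₁ (y , ()) | false | _ | _
  extend-greedily (suc fuel) q qs P | inj₁ (y , ()) | true | false | _
  extend-greedily (suc fuel) q qs P | inj₁ (y , ()) | true | true | true

  maximal-DPath : ∃ λ q → ∃ λ qs → UniqueDPath q qs × (∀ y → extends q (q ∷ qs) y ≡ false)
  maximal-DPath with extend-greedily k d₀ [] ([] ∷ [] , [-] , d₀∈D ∷ [])
  ... | q , qs , P , inj₁ maximal = q , qs , P , maximal
  ... | q , qs , (unique , _ , ⊆D) , inj₂ long = ⊥-elim (<-irrefl refl (begin-strict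
    k                   <⟨ subst (k <_) (+-comm 1 k) (n<1+n k) ⟩
    k + 1               ≤⟨ long ⟩
    length (q ∷ qs)     ≤⟨ length-unique-≤ inD (q ∷ qs) unique ⊆D ⟩
    count inD           ≡⟨ |D|≡k ⟩
    k                   ∎))
    where open ≤-Reasoning

  rotate-at : ∀ q α w β → Linked (Edge G) (q ∷ α ++ w ∷ β) → (∀ {y} → y ∈ₗ β → Edge G q y) →
    Linked (Edge G) (w ∷ reverse (q ∷ α) ++ β)
  rotate-at q α w β path q→β with Linked-++⁻ α path | reverse-∷ q α
  ... | toW , edgeToW , fromW | t , rev≡ = join β fromW q→β
    where
    back : Linked (Edge G) (w ∷ reverse (q ∷ α))
    back = subst (λ z → Linked (Edge G) (w ∷ z)) (sym rev≡)
      (Edge-sym edgeToW ∷ subst (Linked (Edge G)) rev≡ (Linked-reverse Edge-sym toW))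
    ends-at-q : lastOf w (reverse (q ∷ α)) ≡ q
    ends-at-q = trans (cong (lastOf w) (List.unfold-reverse q α)) (lastOf-++ w (reverse α) q [])
    join : ∀ β′ → Linked (Edge G) (w ∷ β′) → (∀ {y} → y ∈ₗ β′ → Edge G q y) → Linked (Edge G) (w ∷ reverse (q ∷ α) ++ β′)
    join [] _ _ = subst (λ z → Linked (Edge G) (w ∷ z)) (sym (List.++-identityʳ _)) back
    join (b ∷ β′) fromW′ q→β′ =
      Linked-++⁺ (reverse (q ∷ α)) back (subst (λ z → Edge G z b) (sym ends-at-q) (q→β′ (here refl))) (Linked-tail fromW′)

  module Middle (s≥2 : 2 ≤ s) (s<k : s < k) where

    |R|≥1 : 1 ≤ length Rl
    |R|≥1 = subst (1 ≤_) (sym length-Rl) (+-cancelˡ-≤ s 1 (count inR)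
      (subst (s + 1 ≤_) (sym s+|R|≡n∸k) (≤-trans (subst (_≤ k) (+-comm 1 s) s<k) k≤n∸k)))

    -- Completed by the uncovered vertices of D as one-vertex paths, the cover still has fewer than s paths.
    few-paths-impossible : ∀ paths → Unique (concatBlocks paths) → All DPath paths →
      length paths + k < length (concatBlocks paths) + s → ⊥
    few-paths-impossible paths unique all-paths bound with complete-path-cover paths unique all-paths
    ... | cover , enumerated , all-cover , length≡ = nonhamiltonian
      (hamiltonian-from-path-cover (members-enumerates inS) (members-enumerates inR) cover enumerated all-cover
        (subst (length cover <_) (sym length-Sl) fewer) |R|≥1)
      where
      fewer : length cover < s
      fewer = +-cancelʳ-≤ (length (concatBlocks paths)) (suc (length cover)) s
        (subst₂ _≤_ (cong suc (sym length≡)) (+-comm (length (concatBlocks paths)) s) bound)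

    long-path-impossible : ∀ q qs → UniqueDPath q qs → ∀ d → inD d ≡ true → 2 + innerDeg d ≤ length (q ∷ qs) → ⊥
    long-path-impossible q qs (unique , path , ⊆D) d d∈D long =
      few-paths-impossible ((q , qs) ∷ []) (subst Unique q∷qs≡ unique) ((path , ⊆D) ∷ [])
        (subst₂ (λ a b → 2 + a ≤ b + s) (innerDeg+s≡k d d∈D) (cong length q∷qs≡) (+-monoˡ-≤ s long))
      where
      q∷qs≡ : q ∷ qs ≡ q ∷ qs ++ []
      q∷qs≡ = cong (q ∷_) (sym (List.++-identityʳ qs))

    -- q is adjacent to all of the path q ∷ qs, which has innerDeg q + 1 vertices; a further edge uw
    -- inside D either is disjoint from the path or yields, by rotation, a path with one vertex more.
    path-and-edge-impossible : ∀ q qs → UniqueDPath q qs → (∀ {y} → y ∈ₗ qs → Edge G q y) →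
      length qs ≡ innerDeg q → ∀ u w → inD u ≡ true → u ∉ₗ (q ∷ qs) → inD w ≡ true → Edge G u w → ⊥
    path-and-edge-impossible q qs P@(unique , path , ⊆D) q→qs |qs|≡r u w u∈D u∉Q w∈D uw
      with w ∈ᵇ (q ∷ qs) in w∈Q
    ... | false = few-paths-impossible ((q , qs) ∷ (u , [ w ]) ∷ [])
      (Unique.++⁺ unique (((λ u≡w → false≢true (trans (sym (G-irrefl u)) (subst (Edge G u) (sym u≡w) uw))) ∷ []) ∷ [] ∷ [])
        λ { (v∈Q , here refl) → u∉Q v∈Q ; (v∈Q , there (here refl)) → ∉ᵇ⇒∉ w∈Q v∈Q })
      ((path , ⊆D) ∷ ((uw ∷ [-]) , u∈D ∷ w∈D ∷ []) ∷ [])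
      (subst₂ (λ a b → 2 + a < b + s) (innerDeg+s≡k q q∈D) (sym (length-path-and-edge)) ≤-refl)
      where
      q∈D = All.lookup ⊆D (here refl)
      length-path-and-edge : length (q ∷ qs ++ u ∷ w ∷ []) ≡ 3 + innerDeg q
      length-path-and-edge =
        trans (cong suc (List.length-++ qs)) (cong suc (trans (cong (_+ 2) |qs|≡r) (+-comm (innerDeg q) 2)))
    ... | true with ∈ᵇ⇒∈ (q ∷ qs) w∈Q
    ...   | here refl = long-path-impossible u (q ∷ qs) (All≢u ∷ unique , uw ∷ path , u∈D ∷ ⊆D) q (All.lookup ⊆D (here refl))
                          (s≤s (s≤s (≤-reflexive (sym |qs|≡r))))
      where All≢u = All.tabulate (λ v∈Q u≡v → u∉Q (subst (_∈ₗ q ∷ qs) (sym u≡v) v∈Q))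
    ...   | there w∈qs with ∈-∃++ w∈qs
    ...     | α , β , refl = long-path-impossible u rotated (Unique-resp-↭ (↭-sym rotated↭) (All≢u ∷ unique) ,
                          uw ∷ rotate-at q α w β path (λ y∈β → q→qs (Any.++⁺ʳ α (there y∈β))) ,
                          All.tabulate (λ v∈ → All.lookup (u∈D ∷ ⊆D) (↭.∈-resp-↭ rotated↭ v∈)))
                          q (All.lookup ⊆D (here refl))
                          (subst (2 + innerDeg q ≤_) (sym (↭.↭-length rotated↭)) (s≤s (s≤s (≤-reflexive (sym |qs|≡r)))))
      where
      All≢u = All.tabulate (λ v∈Q u≡v → u∉Q (subst (_∈ₗ q ∷ α ++ w ∷ β) (sym u≡v) v∈Q))
      rotated : List (Fin n)
      rotated = w ∷ reverse (q ∷ α) ++ β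
      rotated↭ : (u ∷ rotated) ↭ (u ∷ q ∷ α ++ w ∷ β)
      rotated↭ = prep u (↭-trans (↭-sym (↭.shift w (reverse (q ∷ α)) β)) (↭.++⁺ʳ (w ∷ β) (↭.↭-reverse (q ∷ α))))

    maximal-path-impossible : ∀ q qs → UniqueDPath q qs → (∀ y → extends q (q ∷ qs) y ≡ false) → ⊥
    maximal-path-impossible q qs P@(_ ∷ qs-unique , _ , q∈D ∷ _) maximal with innerDeg q ℕ.<? length qs
    ... | yes r<|qs| = long-path-impossible q qs P q q∈D (s≤s r<|qs|)
    ... | no r≮|qs| =
      path-and-edge-impossible q qs P q→qs |qs|≡r u w (∧-true₁ u-outside) (∉ᵇ⇒∉ (not-injective (∧-true₂ u-outside)))
        (∧-true₁ uw′) (∧-true₂ uw′)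
      where
      D-neighbours⊆qs : ∀ y → (inD y ∧ G q y) ≡ true → (y ∈ᵇ qs) ≡ true
      D-neighbours⊆qs y h with y ∈ᵇ qs in y∈qs
      ... | true = refl
      ... | false = ⊥-elim (false≢true (trans (sym (maximal y)) extends-y))
        where
        y≢q : y ≢ q
        y≢q refl = false≢true (trans (sym (G-irrefl q)) (∧-true₂ h))
        extends-y : extends q (q ∷ qs) y ≡ true
        extends-y = cong₂ _∧_ (∧-true₁ {inD y} h) (cong₂ _∧_ (∧-true₂ {inD y} h) (cong not (cong₂ _∨_ (==-≢ y≢q) y∈qs)))
      count-qs : count (_∈ᵇ qs) ≡ length qs
      count-qs = sym (length-unique qs qs-unique)
      |qs|≡r : length qs ≡ innerDeg q
      |qs|≡r = sym (≤-antisym (subst (innerDeg q ≤_) count-qs (count-mono D-neighbours⊆qs)) (≮⇒≥ r≮|qs|))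
      q→qs : ∀ {y} → y ∈ₗ qs → Edge G q y
      q→qs {y} y∈qs =
        ∧-true₂ (count-≡⇒⊇ _ _ D-neighbours⊆qs (trans (sym |qs|≡r) (sym count-qs)) y (∈⇒∈ᵇ y∈qs))
      outside≥1 : 0 < count (outside (q ∷ qs))
      outside≥1 = ≤-pred (subst (2 ≤_) (sym (+-cancelˡ-≡ (innerDeg q) _ s sizes)) s≥2)
        where
        open ≡-Reasoning
        c = count (outside (q ∷ qs))
        sizes : innerDeg q + suc c ≡ innerDeg q + s
        sizes = begin
          innerDeg q + suc c   ≡⟨ +-suc (innerDeg q) c ⟩
          suc (innerDeg q) + c ≡⟨ cong (λ z → suc z + c) (sym |qs|≡r) ⟩
          length (q ∷ qs) + c  ≡⟨ length+outside≡k (q ∷ qs) (proj₁ P) (proj₂ (proj₂ P)) ⟩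
          k                    ≡⟨ sym (innerDeg+s≡k q q∈D) ⟩
          innerDeg q + s       ∎
      u = proj₁ (count>0⇒∃ (outside (q ∷ qs)) outside≥1)
      u-outside = proj₂ (count>0⇒∃ (outside (q ∷ qs)) outside≥1)
      innerDeg-u≥1 : 0 < innerDeg u
      innerDeg-u≥1 with innerDeg u in r≡ | innerDeg+s≡k u (∧-true₁ u-outside)
      ... | zero | s≡k = ⊥-elim (<-irrefl s≡k s<k)
      ... | suc _ | _ = s≤s z≤n
      w = proj₁ (count>0⇒∃ (λ y → inD y ∧ G u y) innerDeg-u≥1)
      uw′ = proj₂ (count>0⇒∃ (λ y → inD y ∧ G u y) innerDeg-u≥1)

    impossible : ⊥
    impossible with maximal-DPath
    ... | q , qs , P , maximal = maximal-path-impossible q qs P maximal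

  s≡k⇒D-independent : s ≡ k → ∀ u v → inD u ≡ true → inD v ≡ true → G u v ≡ false
  s≡k⇒D-independent s≡k u v u∈D v∈D =
    subst (λ b → (b ∧ G u v) ≡ false) v∈D (count≡0⇒false (λ y → inD y ∧ G u y) innerDeg≡0 v)
    where
    innerDeg≡0 : innerDeg u ≡ 0
    innerDeg≡0 = +-cancelʳ-≡ s (innerDeg u) 0 (trans (innerDeg+s≡k u u∈D) (sym s≡k))

  s≡1⇒D-clique : s ≡ 1 → ∀ u v → inD u ≡ true → inD v ≡ true → u ≢ v → G u v ≡ true
  s≡1⇒D-clique s≡1 u v u∈D v∈D u≢v = ∧-true₂ {inD v}
    (count-≡⇒⊇ _ _ (D-neighbour-in-D-∖ u u∈D) innerDeg≡ v (cong₂ _∧_ v∈D (cong not (==-≢ λ v≡u → u≢v (sym v≡u)))))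
    where
    innerDeg≡ : innerDeg u ≡ count (λ y → inD y ∧ not (y == u))
    innerDeg≡ = suc-injective (begin
      suc (innerDeg u)                          ≡⟨ +-comm 1 (innerDeg u) ⟩
      innerDeg u + 1                            ≡⟨ cong (innerDeg u +_) (sym s≡1) ⟩
      innerDeg u + s                            ≡⟨ innerDeg+s≡k u u∈D ⟩
      k                                         ≡⟨ sym |D|≡k ⟩
      count inD                                 ≡⟨ count-remove inD u u∈D ⟩
      suc (count (λ y → inD y ∧ not (y == u)))  ∎)
      where open ≡-Reasoning

  classification : (G ≅ H n k) ⊎ (G ≅ H′ n k)
  classification with s ℕ.≟ k
  ... | yes s≡k = inj₁ (≅H.iso s≡k (s≡k⇒D-independent s≡k))
  ... | no s≢k with s ℕ.≟ 1
  ...   | yes s≡1 = inj₂ (≅H′.iso s≡1 (s≡1⇒D-clique s≡1))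
  ...   | no s≢1 = ⊥-elim (Middle.impossible s≥2 s<k)
    where
    s≥2 : 2 ≤ s
    s≥2 = ≤∧≢⇒< s≥1 (λ 1≡s → s≢1 (sym 1≡s))
    s<k : s < k
    s<k = ≤∧≢⇒< (subst (s ≤_) (innerDeg+s≡k d₀ d₀∈D) (m≤n+m s (innerDeg d₀))) s≢k

∣∣≡count : ∀ {n} (D : Subset n) → ∣ D ∣ ≡ count (lookup D)
∣∣≡count [] = refl
∣∣≡count (true ∷ D) = cong suc (∣∣≡count D)
∣∣≡count (false ∷ D) = ∣∣≡count D

≤half⇒2k<n : ∀ n k → 1 ≤ k → k ≤ (n ∸ 1) / 2 → suc (k + k) ≤ n
≤half⇒2k<n zero k k≥1 k≤ = ⊥-elim (<-irrefl refl (≤-trans k≥1 k≤))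
≤half⇒2k<n (suc n) k k≥1 k≤ =
  s≤s (subst (_≤ n) (trans (*-comm k 2) (cong (k +_) (+-identityʳ k))) (≤-trans (*-monoˡ-≤ 2 k≤) (m/n*n≤m n 2)))

lemma7 : (n : ℕ) (G : Graph n) → IsSimple G → Saturated G →
    h n ((n ∸ 1) / 2) < e G →
    (k : ℕ) → IsMinDegree G k → 1 ≤ k → k ≤ (n ∸ 1) / 2 →
    (D : Subset n) → ∣ D ∣ ≡ k →
    (∀ (v : Fin n) → v ∈ D → deg G v ≤ k) →
    (∀ (u v : Fin n) → u ∉ D → v ∉ D → u ≢ v → G u v ≡ true) →
    (G ≅ H n k) ⊎ (G ≅ H′ n k)
lemma7 n G (G-sym , G-irrefl) (nonhamiltonian , saturated) _ k (k≤deg , _) k≥1 k≤ D |D|≡k deg-D≤k A-complete =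
  Configuration.classification G G-sym G-irrefl nonhamiltonian saturated k k≤deg k≥1 (≤half⇒2k<n n k k≥1 k≤)
    (lookup D) (trans (sym (∣∣≡count D)) |D|≡k)
    (λ v v∈D → deg-D≤k v (lookup⇒[]= v D v∈D))
    (λ u v u∉D v∉D → A-complete u v (∉ u∉D) (∉ v∉D))
  where
  ∉ : ∀ {v} → lookup D v ≡ false → v ∉ D
  ∉ v∉D v∈D = false≢true (trans (sym v∉D) ([]=⇒lookup v∈D))
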